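{- Let $p>2$ be a prime, let $t$ be a positive divisor of $p-1$ and let $k$ be an integer with $1<k<p/2$. Put $r_0(k)=\left\lfloor \frac{\log(p/2)}{\log k}\right\rfloor$ and $s=s_0(k,t)=\max\left\{s'\in\mathbb{Z}_{\ge 0}~:~\binom{r_0(k)+s'}{s'}\le t\right\}$. Then $$\#\{|x|~:~x\in U(k,t,1)\}\le\Psi(k,p_{s}).$$
   Context: $\mathbb{F}_p$ is the field of residues modulo $p$. For $x\in\mathbb{F}_p$ its integer height is $|x|=\min\{|a|~:~a\in\mathbb{Z},\ a\equiv x \pmod p\}$. For $t\mid p-1$, $G$ is the unique subgroup of $\mathbb{F}_p^*$ of order $t$, and $U(k,t,1)=\{x\in G~:~|x|\le k\}$. $\Psi(x,y)$ is the number of positive integers $n\le x$ all of whose prime factors are at most $y$. $p_j$ is the $j$-th prime ($p_1=2$); by convention $\Psi(x,p_0)=1$ for $x\ge1$ (only $1$ has no prime factors). -}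

module Defs where

open import Data.Nat using (ℕ; zero; suc; _+_; _*_; _∸_; _^_; _≤_; _<_; _⊓_; NonZero)
open import Data.Nat.Properties using (_≟_; _≤?_)
open import Data.Nat.DivMod using (_%_)
open import Data.Nat.Divisibility using (_∣_; _∣?_)
open import Data.Nat.Primality using (Prime; prime?)
open import Data.Nat.Combinatorics using (_C_)
open import Data.List using (List; length; filter; map; upTo; deduplicate)
open import Data.List.Relation.Unary.All using (All; all?)
open import Data.Product using (_×_)
open import Relation.Binary.PropositionalEquality using (_≡_)
open import Relation.Nullary.Decidable using (Dec; _×-dec_; _→-dec_)

-- Elements of F_p are represented by their canonical residues x ∈ {0,…,p-1}.

-- Integer height |x| = min{|a| : a ≡ x mod p} of the residue x ∈ {0,…,p-1}.
height : ℕ → ℕ → ℕ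
height p x = x ⊓ (p ∸ x)

-- x ∈ G : G is the unique subgroup of F_p^* of order t (t ∣ p-1),
-- i.e. G = {x ∈ F_p^* : x^t = 1}.
InG : (p t : ℕ) .{{_ : NonZero p}} → ℕ → Set
InG p t x = (x ^ t) % p ≡ 1

InU : (p k t : ℕ) .{{_ : NonZero p}} → ℕ → Set
InU p k t x = InG p t x × height p x ≤ k

InU? : (p k t : ℕ) .{{_ : NonZero p}} → (x : ℕ) → Dec (InU p k t x)
InU? p k t x = (((x ^ t) % p) ≟ 1) ×-dec (height p x ≤? k)

Ulist : (p k t : ℕ) .{{_ : NonZero p}} → List ℕ
Ulist p k t = filter (InU? p k t) (upTo p)

numHeights : (p k t : ℕ) .{{_ : NonZero p}} → ℕ
numHeights p k t = length (deduplicate _≟_ (map (height p) (Ulist p k t)))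

-- π(q) = number of primes ≤ q.  For a prime q, q = p_j iff π(q) = j,
-- so for primes q:  q ≤ p_s  iff  π(q) ≤ s  (for s = 0 no prime qualifies,
-- matching the convention Ψ(x,p_0) = 1).
primePi : ℕ → ℕ
primePi q = length (filter prime? (upTo (suc q)))

-- n has all its prime factors ≤ p_s.  (Every divisor q of n ≥ 1 satisfies q ≤ n,
-- so checking q ∈ {0,…,n} suffices.)
SmoothIdx : ℕ → ℕ → Set
SmoothIdx s n = All (λ q → Prime q → q ∣ n → primePi q ≤ s) (upTo (suc n))

SmoothIdx? : (s n : ℕ) → Dec (SmoothIdx s n)
SmoothIdx? s n = all? (λ q → prime? q →-dec ((q ∣? n) →-dec (primePi q ≤? s))) (upTo (suc n))

PsiIdx : ℕ → ℕ → ℕ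
PsiIdx x s = length (filter (SmoothIdx? s) (map suc (upTo x)))

-- r₀(k) = ⌊log(p/2)/log k⌋ = max{ r ∈ ℕ : k^r ≤ p/2 } = max{ r : 2·k^r ≤ p } (k > 1).
IsR0 : (p k r : ℕ) → Set
IsR0 p k r = (2 * k ^ r ≤ p) × (∀ r′ → 2 * k ^ r′ ≤ p → r′ ≤ r)

IsS0 : (r t s : ℕ) → Set
IsS0 r t s = ((r + s) C s ≤ t) × (∀ s′ → (r + s′) C s′ ≤ t → s′ ≤ s)

{-# OPTIONS --safe #-}
module Submission where

-- Integer Gaussian elimination on the prime-exponent vectors of the heights |x|, x ∈ U, yields
-- elements x₁, …, x_d ∈ U whose heights are multiplicatively independent, together with pivot
-- primes c₁ > ⋯ > c_d at which the valuations already determine every height.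
-- (1) For exponents e with Σeᵢ ≤ r₀ the products ∏ xᵢ^eᵢ lie in G, and their heights are the
-- integers ∏ |xᵢ|^eᵢ ≤ k^r₀ ≤ p/2, which are distinct by independence; so these are
-- binom(r₀ + d, d) distinct roots of Xᵗ - 1 in 𝔽ₚ, whence binom(r₀ + d, d) ≤ t and d ≤ s.
-- (2) Replacing cᵢ by the i-th prime Pᵢ ≤ cᵢ in the factorisation of each height maps the heights
-- injectively to p_d-smooth integers in [1, k], so there are at most Ψ(k, p_s) of them.

module MonicRoots where

  open import Data.Nat as ℕ using (ℕ; suc; z≤n; s≤s; _∸_)
  import Data.Nat.Properties as ℕ
  open import Data.Nat.DivMod using (m<n⇒m%n≡m)
  import Data.Nat.Divisibility as ℕ
  open import Data.Nat.Divisibility using (∣1⇒≡1)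
  open import Data.Nat.Primality using (Prime; euclidsLemma; ¬prime[1])
  open import Data.Integer using (ℤ; +_; _+_; _*_; -_; _-_; ∣_∣)
  open import Data.Integer.Properties using (abs-*; m-n≡m⊖n; ∣⊖∣-≤; ∣m⊖n∣≡∣n⊖m∣)
  open import Data.Integer.Divisibility.Signed
  open import Data.Integer.Tactic.RingSolver using (solve-∀)
  open import Data.List using (List; []; _∷_; length)
  open import Data.List.Relation.Unary.All as All using (All; _∷_)
  open import Data.List.Relation.Unary.AllPairs using (_∷_)
  open import Data.List.Relation.Unary.Unique.Propositional using (Unique)
  open import Data.Product using (_×_; _,_; proj₁; proj₂)
  open import Data.Sum using (_⊎_; inj₁; inj₂; map)
  open import Relation.Nullary using (¬_; contradiction)
  open import Relation.Binary.PropositionalEquality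

  prime∣*⇒∣⊎∣ : ∀ {p} → Prime p → ∀ a b → + p ∣ a * b → (+ p ∣ a) ⊎ (+ p ∣ b)
  prime∣*⇒∣⊎∣ {p} pr a b p∣ab =
    map ∣ᵤ⇒∣ ∣ᵤ⇒∣ (euclidsLemma ∣ a ∣ ∣ b ∣ pr (subst (p ℕ.∣_) (abs-* a b) (∣⇒∣ᵤ p∣ab)))

  <∧∣⇒≡0 : ∀ {p n} → n ℕ.< p → p ℕ.∣ n → n ≡ 0
  <∧∣⇒≡0 {p} {n} n<p p∣n = trans (sym (m<n⇒m%n≡m n<p)) (ℕ.n∣m⇒m%n≡0 n p p∣n)
    where instance _ = ℕ.>-nonZero (ℕ.≤-<-trans z≤n n<p)

  residues-≡ : ∀ {p a b} → a ℕ.< p → b ℕ.< p → + p ∣ + a - + b → a ≡ b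
  residues-≡ {p} {a} {b} a<p b<p p∣a-b with ℕ.≤-total a b
  ... | inj₁ a≤b = ℕ.≤-antisym a≤b (ℕ.m∸n≡0⇒m≤n (<∧∣⇒≡0 (ℕ.≤-<-trans (ℕ.m∸n≤m b a) b<p) p∣b∸a))
    where
    p∣b∸a : p ℕ.∣ b ∸ a
    p∣b∸a = subst (p ℕ.∣_) (trans (cong ∣_∣ (m-n≡m⊖n a b)) (∣⊖∣-≤ a≤b)) (∣⇒∣ᵤ p∣a-b)
  ... | inj₂ b≤a = sym (ℕ.≤-antisym b≤a (ℕ.m∸n≡0⇒m≤n (<∧∣⇒≡0 (ℕ.≤-<-trans (ℕ.m∸n≤m a b) a<p) p∣a∸b)))
    where
    p∣a∸b : p ℕ.∣ a ∸ b
    p∣a∸b = subst (p ℕ.∣_) (trans (cong ∣_∣ (m-n≡m⊖n a b)) (trans (∣m⊖n∣≡∣n⊖m∣ a b) (∣⊖∣-≤ b≤a))) (∣⇒∣ᵤ p∣a-b)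

  prime∤1 : ∀ {p} → Prime p → ¬ (+ p ∣ + 1)
  prime∤1 pr p∣1 = ¬prime[1] (subst Prime (∣1⇒≡1 (∣⇒∣ᵤ p∣1)) pr)

  -- The list [c₀, …, c₍ₙ₋₁₎] stands for the monic polynomial c₀ + c₁x + ⋯ + c₍ₙ₋₁₎xⁿ⁻¹ + xⁿ.
  evalMonic : List ℤ → ℤ → ℤ
  evalMonic []       x = + 1
  evalMonic (c ∷ cs) x = c + x * evalMonic cs x

  syntheticDivision : ℤ → ℤ → List ℤ → List ℤ × ℤ
  syntheticDivision a c []        = [] , c + a
  syntheticDivision a c (c′ ∷ cs) =
    let (q , r) = syntheticDivision a c′ cs in (r ∷ q) , c + a * r

  length-syntheticDivision : ∀ a c cs → length (proj₁ (syntheticDivision a c cs)) ≡ length cs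
  length-syntheticDivision a c []        = refl
  length-syntheticDivision a c (c′ ∷ cs) = cong suc (length-syntheticDivision a c′ cs)

  evalMonic-syntheticDivision : ∀ a c cs x →
    let (q , r) = syntheticDivision a c cs in evalMonic (c ∷ cs) x ≡ (x - a) * evalMonic q x + r
  evalMonic-syntheticDivision a c []        x = linear c x a
    where
    linear : ∀ c x a → c + x * + 1 ≡ (x - a) * + 1 + (c + a)
    linear = solve-∀
  evalMonic-syntheticDivision a c (c′ ∷ cs) x =
    trans (cong (λ y → c + x * y) (evalMonic-syntheticDivision a c′ cs x)) (horner c x a _ _)
    where
    horner : ∀ c x a q r → c + x * ((x - a) * q + r) ≡ (x - a) * (r + x * q) + (c + a * r)
    horner = solve-∀

  roots≤degree : ∀ {p} → Prime p → (f : List ℤ) {rs : List ℕ} → Unique rs → All (ℕ._< p) rs →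
    All (λ b → + p ∣ evalMonic f (+ b)) rs → length rs ℕ.≤ length f
  roots≤degree pr f        {[]}     _ _ _ = z≤n
  roots≤degree pr []       {a ∷ rs} _ _ (p∣1 ∷ _) = contradiction p∣1 (prime∤1 pr)
  roots≤degree {p} pr (c ∷ cs) {a ∷ rs} (a∉rs ∷ distinct) (a<p ∷ rs<p) (p∣f[a] ∷ p∣f[rs]) =
    subst (λ n → suc (length rs) ℕ.≤ suc n) (length-syntheticDivision (+ a) c cs)
      (s≤s (roots≤degree pr q distinct rs<p (All.zipWith rootOfQuotient (All.zip (a∉rs , rs<p) , p∣f[rs]))))
    where
    q = proj₁ (syntheticDivision (+ a) c cs)
    r = proj₂ (syntheticDivision (+ a) c cs)
    p∣r : + p ∣ r
    p∣r = subst (+ p ∣_) (trans (evalMonic-syntheticDivision (+ a) c cs (+ a)) (vanish (+ a) (evalMonic q (+ a)) r)) p∣f[a]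
      where
      vanish : ∀ a y r → (a - a) * y + r ≡ r
      vanish = solve-∀
    rootOfQuotient : ∀ {b} → (a ≢ b × b ℕ.< p) × (+ p ∣ evalMonic (c ∷ cs) (+ b)) → + p ∣ evalMonic q (+ b)
    rootOfQuotient {b} ((a≢b , b<p) , p∣f[b])
      with prime∣*⇒∣⊎∣ pr (+ b - + a) (evalMonic q (+ b))
             (∣m+n∣n⇒∣m (subst (+ p ∣_) (evalMonic-syntheticDivision (+ a) c cs (+ b)) p∣f[b]) p∣r)
    ... | inj₁ p∣b-a = contradiction (sym (residues-≡ b<p a<p p∣b-a)) a≢b
    ... | inj₂ p∣q[b] = p∣q[b]

module Valuation where

  open import Data.Nat
  open import Data.Nat.Properties
  open import Data.Nat.Divisibility
  open import Data.Nat.Primality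
  open import Data.Nat.Induction using (<-rec)
  open import Data.Nat.Tactic.RingSolver using (solve-∀)
  open import Data.Product using (Σ; _×_; _,_)
  open import Data.Sum using ([_,_]′)
  open import Relation.Nullary using (¬_; yes; no; contradiction)
  open import Relation.Binary.PropositionalEquality
  open import Function.Base using (case_of_)
  open import Relation.Binary.Definitions using (tri<; tri≈; tri>)

  record IsValuation (q n v : ℕ) : Set where
    constructor isValuation
    field
      power∣     : q ^ v ∣ n
      nextPower∤ : ¬ (q ^ suc v ∣ n)

  -- Each step divides n ≥ 1 by q ≥ 2, so fuel n is enough.
  valuationWithFuel : ℕ → ℕ → ℕ → ℕ
  valuationWithFuel zero       q n = 0
  valuationWithFuel (suc fuel) q n with q ∣? n
  ... | yes q∣n = suc (valuationWithFuel fuel q (quotient q∣n))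
  ... | no  _ = 0

  valuation : ℕ → ℕ → ℕ
  valuation zero    n = 0
  valuation (suc q) n = valuationWithFuel n (suc q) n

  prime⇒≥2 : ∀ {q} → Prime q → 2 ≤ q
  prime⇒≥2 {suc (suc _)} _ = s≤s (s≤s z≤n)

  prime⇒≥1 : ∀ {q} → Prime q → 1 ≤ q
  prime⇒≥1 pr = <⇒≤ (prime⇒≥2 pr)

  prime∤1 : ∀ {q} → Prime q → ¬ (q ∣ 1)
  prime∤1 pr q∣1 = ¬prime[1] (subst Prime (∣1⇒≡1 q∣1) pr)

  1≤*1≤ : ∀ {a b} → 1 ≤ a → 1 ≤ b → 1 ≤ a * b
  1≤*1≤ {suc a} {suc b} _ _ = s≤s z≤n

  1≤^ : ∀ {c} e → 1 ≤ c → 1 ≤ c ^ e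
  1≤^ zero    _   = s≤s z≤n
  1≤^ (suc e) 1≤c = 1≤*1≤ 1≤c (1≤^ e 1≤c)

  1≤*⇒1≤ : ∀ a b → 1 ≤ a * b → 1 ≤ a
  1≤*⇒1≤ (suc a) b _ = s≤s z≤n

  ^-mono-∣ : ∀ q {a b} → a ≤ b → q ^ a ∣ q ^ b
  ^-mono-∣ q {a} {b} a≤b = divides (q ^ (b ∸ a)) (begin
    q ^ b               ≡⟨ cong (q ^_) (m+[n∸m]≡n a≤b) ⟨
    q ^ (a + (b ∸ a))   ≡⟨ ^-distribˡ-+-* q a (b ∸ a) ⟩
    q ^ a * q ^ (b ∸ a) ≡⟨ *-comm (q ^ a) (q ^ (b ∸ a)) ⟩
    q ^ (b ∸ a) * q ^ a ∎)
    where open ≡-Reasoning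

  isValuation-valuationWithFuel : ∀ fuel q n → 1 ≤ n → n ≤ fuel →
    IsValuation (2 + q) n (valuationWithFuel fuel (2 + q) n)
  isValuation-valuationWithFuel zero       q n 1≤n n≤0 = contradiction (≤-trans 1≤n n≤0) λ ()
  isValuation-valuationWithFuel (suc fuel) q n 1≤n n≤fuel with 2 + q ∣? n
  ... | no q∤n = isValuation (1∣ n) λ q∣n → q∤n (subst (_∣ n) (*-identityʳ (2 + q)) q∣n)
  ... | yes (divides m refl) =
    isValuation (subst (_∣ m * Q) (*-comm (Q ^ v) Q) (*-monoˡ-∣ Q power∣))
      λ Qᵛ⁺²∣ → nextPower∤ (*-cancelʳ-∣ Q (subst (_∣ m * Q) (*-comm Q (Q ^ suc v)) Qᵛ⁺²∣))
    where
    Q = 2 + q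
    1≤m = 1≤*⇒1≤ m Q 1≤n
    m<n : m < m * Q
    m<n = subst (_< m * Q) (*-identityʳ m) (*-monoʳ-< m {{>-nonZero 1≤m}} (s≤s (s≤s z≤n)))
    v = valuationWithFuel fuel Q m
    open IsValuation (isValuation-valuationWithFuel fuel q m 1≤m (≤-pred (≤-trans m<n n≤fuel)))

  isValuation-valuation : ∀ {q n} → Prime q → 1 ≤ n → IsValuation q n (valuation q n)
  isValuation-valuation {suc (suc q)} {n} _ 1≤n = isValuation-valuationWithFuel n q n 1≤n ≤-refl

  isValuation-unique : ∀ {q n v w} → IsValuation q n v → IsValuation q n w → v ≡ w
  isValuation-unique {q} {v = v} {w} (isValuation qᵛ∣n qᵛ⁺¹∤n) (isValuation qʷ∣n qʷ⁺¹∤n) with <-cmp v w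
  ... | tri≈ _ v≡w _ = v≡w
  ... | tri< v<w _ _ = contradiction (∣-trans (^-mono-∣ q v<w) qʷ∣n) qᵛ⁺¹∤n
  ... | tri> _ _ w<v = contradiction (∣-trans (^-mono-∣ q w<v) qᵛ∣n) qʷ⁺¹∤n

  valuation-unique : ∀ {q n v} → Prime q → 1 ≤ n → IsValuation q n v → valuation q n ≡ v
  valuation-unique pr 1≤n = isValuation-unique (isValuation-valuation pr 1≤n)

  coprimeCofactor : ∀ {q n v} → IsValuation q n v → Σ ℕ λ m → n ≡ m * q ^ v × ¬ (q ∣ m)
  coprimeCofactor {q} {n} {v} (isValuation (divides m n≡mqᵛ) qᵛ⁺¹∤n) = m , n≡mqᵛ , q∤m
    where
    q∤m : ¬ (q ∣ m)
    q∤m (divides x m≡xq) = qᵛ⁺¹∤n (divides x (begin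
      n             ≡⟨ n≡mqᵛ ⟩
      m * q ^ v     ≡⟨ cong (_* q ^ v) m≡xq ⟩
      x * q * q ^ v ≡⟨ *-assoc x q (q ^ v) ⟩
      x * q ^ suc v ∎))
      where open ≡-Reasoning

  valuation-cofactor : ∀ {q m} → Prime q → ¬ (q ∣ m) → ∀ v → valuation q (m * q ^ v) ≡ v
  valuation-cofactor {q} {m} pr q∤m v = valuation-unique pr 1≤mqᵛ (isValuation (n∣m*n m) qᵛ⁺¹∤mqᵛ)
    where
    instance _ = m^n≢0 q v {{prime⇒nonZero pr}}
    1≤m : 1 ≤ m
    1≤m = n≢0⇒n>0 λ { refl → q∤m (q ∣0) }
    1≤mqᵛ = 1≤*1≤ 1≤m (1≤^ v (prime⇒≥1 pr))
    qᵛ⁺¹∤mqᵛ : ¬ (q ^ suc v ∣ m * q ^ v)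
    qᵛ⁺¹∤mqᵛ qᵛ⁺¹∣ = q∤m (*-cancelʳ-∣ (q ^ v) qᵛ⁺¹∣)

  valuation-* : ∀ {q a b} → Prime q → 1 ≤ a → 1 ≤ b →
    valuation q (a * b) ≡ valuation q a + valuation q b
  valuation-* {q} {a} {b} pr 1≤a 1≤b
    with coprimeCofactor (isValuation-valuation pr 1≤a) | coprimeCofactor (isValuation-valuation pr 1≤b)
  ... | a′ , a≡ , q∤a′ | b′ , b≡ , q∤b′ = trans (cong (valuation q) ab≡) (valuation-cofactor pr q∤a′b′ (u + v))
    where
    u = valuation q a
    v = valuation q b
    q∤a′b′ : ¬ (q ∣ a′ * b′)
    q∤a′b′ q∣a′b′ = [ q∤a′ , q∤b′ ]′ (euclidsLemma a′ b′ pr q∣a′b′)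
    regroup : ∀ x y z w → x * y * (z * w) ≡ x * z * (y * w)
    regroup = solve-∀
    ab≡ : a * b ≡ a′ * b′ * q ^ (u + v)
    ab≡ = begin
      a * b                       ≡⟨ cong₂ _*_ a≡ b≡ ⟩
      a′ * q ^ u * (b′ * q ^ v)   ≡⟨ regroup a′ (q ^ u) b′ (q ^ v) ⟩
      a′ * b′ * (q ^ u * q ^ v)   ≡⟨ cong (a′ * b′ *_) (^-distribˡ-+-* q u v) ⟨
      a′ * b′ * q ^ (u + v)       ∎
      where open ≡-Reasoning

  valuation-self^ : ∀ {q} → Prime q → ∀ e → valuation q (q ^ e) ≡ e
  valuation-self^ {q} pr e =
    trans (cong (valuation q) (sym (*-identityˡ (q ^ e)))) (valuation-cofactor pr (prime∤1 pr) e)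

  valuation-1 : ∀ {q} → Prime q → valuation q 1 ≡ 0
  valuation-1 pr = valuation-self^ pr 0

  valuation-^ : ∀ {q c} e → Prime q → 1 ≤ c → valuation q (c ^ e) ≡ e * valuation q c
  valuation-^ zero    pr 1≤c = valuation-1 pr
  valuation-^ {q} {c} (suc e) pr 1≤c =
    trans (valuation-* pr 1≤c (1≤^ e 1≤c)) (cong (valuation q c +_) (valuation-^ e pr 1≤c))

  valuation-< : ∀ {q n} → Prime q → 1 ≤ n → n < q → valuation q n ≡ 0
  valuation-< {q} {n} pr 1≤n n<q = trans (cong (valuation q) (sym (*-identityʳ n))) (valuation-cofactor pr q∤n 0)
    where
    q∤n : ¬ (q ∣ n)
    q∤n q∣n = <⇒≱ n<q (∣⇒≤ {{>-nonZero 1≤n}} q∣n)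

  valuation-other^ : ∀ {q r} → Prime q → Prime r → q ≢ r → ∀ e → valuation q (r ^ e) ≡ 0
  valuation-other^ {q} {r} pq pr q≢r e =
    trans (cong (valuation q) (sym (*-identityʳ (r ^ e)))) (valuation-cofactor pq (q∤rᵉ e) 0)
    where
    q∤r : ¬ (q ∣ r)
    q∤r q∣r = [ (λ q≡1 → ¬prime[1] (subst Prime q≡1 pq)) , q≢r ]′ (prime⇒irreducible pr q∣r)
    q∤rᵉ : ∀ e → ¬ (q ∣ r ^ e)
    q∤rᵉ zero    = prime∤1 pq
    q∤rᵉ (suc e) q∣rᵉ⁺¹ = [ q∤r , q∤rᵉ e ]′ (euclidsLemma r (r ^ e) pq q∣rᵉ⁺¹)

  ∣⇒valuation≥1 : ∀ {q n} → Prime q → 1 ≤ n → q ∣ n → 1 ≤ valuation q n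
  ∣⇒valuation≥1 {q} {n} pr 1≤n q∣n with valuation q n | isValuation-valuation {q} {n} pr 1≤n
  ... | zero  | isValuation _ q∤n = contradiction (subst (_∣ n) (sym (*-identityʳ q)) q∣n) q∤n
  ... | suc _ | _                 = s≤s z≤n

  valuation≥1⇒∣ : ∀ {q n} → Prime q → 1 ≤ n → 1 ≤ valuation q n → q ∣ n
  valuation≥1⇒∣ {q} {n} pr 1≤n 1≤v = ∣-trans (subst (_∣ q ^ valuation q n) (*-identityʳ q) (^-mono-∣ q 1≤v))
                                             (IsValuation.power∣ (isValuation-valuation pr 1≤n))

  primeDivisor : ∀ n → 2 ≤ n → Σ ℕ λ q → Prime q × q ∣ n
  primeDivisor = <-rec _ λ where
    n rec 2≤n → case prime? n of λ where
      (yes pr) → n , pr , ∣-refl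
      (no ¬pr) → case ¬prime⇒composite {{n>1⇒nonTrivial 2≤n}} ¬pr of λ where
        (hasNonTrivialDivisor {d} {{nontrivial}} d<n d∣n) →
          let q , pr , q∣d = rec d<n (nonTrivial⇒n>1 d {{nontrivial}}) in q , pr , ∣-trans q∣d d∣n

  valuations≤⇒∣ : ∀ g h → 1 ≤ g → 1 ≤ h → (∀ q → Prime q → valuation q g ≤ valuation q h) → g ∣ h
  valuations≤⇒∣ = <-rec _ step
    where
    step : ∀ g → (∀ {g′} → g′ < g → ∀ h → 1 ≤ g′ → 1 ≤ h →
                  (∀ q → Prime q → valuation q g′ ≤ valuation q h) → g′ ∣ h) →
           ∀ h → 1 ≤ g → 1 ≤ h → (∀ q → Prime q → valuation q g ≤ valuation q h) → g ∣ h
    step 1               _   h _   _   _  = 1∣ h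
    step g@(suc (suc _)) rec h 1≤g 1≤h ν≤ with primeDivisor g (s≤s (s≤s z≤n))
    ... | q , pr , divides g′ g≡g′q
      with valuation≥1⇒∣ pr 1≤h (≤-trans (∣⇒valuation≥1 pr 1≤g (divides g′ g≡g′q)) (ν≤ q pr))
    ... | divides h′ h≡h′q =
      subst₂ _∣_ (sym g≡g′q) (sym h≡h′q) (*-monoˡ-∣ q (rec g′<g h′ 1≤g′ 1≤h′ ν≤′))
      where
      1≤q = prime⇒≥1 pr
      1≤g′ = 1≤*⇒1≤ g′ q (subst (1 ≤_) g≡g′q 1≤g)
      1≤h′ = 1≤*⇒1≤ h′ q (subst (1 ≤_) h≡h′q 1≤h)
      g′<g : g′ < g
      g′<g = subst (g′ <_) (sym g≡g′q)
               (subst (_< g′ * q) (*-identityʳ g′) (*-monoʳ-< g′ {{>-nonZero 1≤g′}} (prime⇒≥2 pr)))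
      ν≤′ : ∀ r → Prime r → valuation r g′ ≤ valuation r h′
      ν≤′ r pr′ = +-cancelʳ-≤ (valuation r q) (valuation r g′) (valuation r h′)
        (subst₂ _≤_ (trans (cong (valuation r) g≡g′q) (valuation-* pr′ 1≤g′ 1≤q))
                    (trans (cong (valuation r) h≡h′q) (valuation-* pr′ 1≤h′ 1≤q)) (ν≤ r pr′))

module Exponents where

  open import Data.Nat as ℕ using (ℕ; _≤_; _<_)
  open import Data.Nat.Properties as ℕ using (≤-reflexive)
  open import Data.Nat.Divisibility using (∣-antisym)
  open import Data.Nat.Primality using (Prime; prime?)
  open import Data.Integer using (ℤ; +_; _+_; _*_)
  open import Data.Integer.Properties using (pos-*; +-injective; *-zeroʳ)
  open import Relation.Nullary using (¬_; yes; no; contradiction)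
  open import Relation.Binary.PropositionalEquality
  open Valuation

  exponent : ℕ → ℕ → ℤ
  exponent n q with prime? q
  ... | yes _ = + valuation q n
  ... | no  _ = + 0

  exponent-prime : ∀ {q} n → Prime q → exponent n q ≡ + valuation q n
  exponent-prime {q} n pr with prime? q
  ... | yes _  = refl
  ... | no ¬pr = contradiction pr ¬pr

  exponent-nonPrime : ∀ {q} n → ¬ Prime q → exponent n q ≡ + 0
  exponent-nonPrime {q} n ¬pr with prime? q
  ... | yes pr = contradiction pr ¬pr
  ... | no  _  = refl

  exponent-1 : ∀ q → exponent 1 q ≡ + 0
  exponent-1 q with prime? q
  ... | yes pr = cong +_ (valuation-1 pr)
  ... | no  _  = refl

  exponent-* : ∀ {a b} → 1 ≤ a → 1 ≤ b → ∀ q → exponent (a ℕ.* b) q ≡ exponent a q + exponent b q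
  exponent-* 1≤a 1≤b q with prime? q
  ... | yes pr = cong +_ (valuation-* pr 1≤a 1≤b)
  ... | no  _  = refl

  exponent-^ : ∀ {c} → 1 ≤ c → ∀ e q → exponent (c ℕ.^ e) q ≡ + e * exponent c q
  exponent-^ {c} 1≤c e q with prime? q
  ... | yes pr = trans (cong +_ (valuation-^ e pr 1≤c)) (pos-* e (valuation q c))
  ... | no  _  = sym (*-zeroʳ (+ e))

  exponent-< : ∀ {n} → 1 ≤ n → ∀ q → n < q → exponent n q ≡ + 0
  exponent-< 1≤n q n<q with prime? q
  ... | yes pr = cong +_ (valuation-< pr 1≤n n<q)
  ... | no  _  = refl

  exponent-injective : ∀ {a b} → 1 ≤ a → 1 ≤ b → (∀ q → exponent a q ≡ exponent b q) → a ≡ b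
  exponent-injective {a} {b} 1≤a 1≤b a≈b =
    ∣-antisym (valuations≤⇒∣ a b 1≤a 1≤b λ q pr → ≤-reflexive (ν≡ q pr))
              (valuations≤⇒∣ b a 1≤b 1≤a λ q pr → ≤-reflexive (sym (ν≡ q pr)))
    where
    ν≡ : ∀ q → Prime q → valuation q a ≡ valuation q b
    ν≡ q pr = +-injective (trans (sym (exponent-prime a pr)) (trans (a≈b q) (exponent-prime b pr)))

module Counting where

  open import Data.Nat using (ℕ; zero; suc; _+_; _≤_; z≤n; s≤s)
  open import Data.Nat.Properties using (+-suc; ≤-reflexive; suc-injective)
  open import Data.Nat.ListAction using (sum)
  open import Data.Nat.Combinatorics using (_C_; nCn≡1; nCk+nC[k+1]≡[n+1]C[k+1])
  open import Data.List using (List; []; _∷_; length; map; _++_; replicate)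
  open import Data.List.Properties using (length-map; length-++; length-replicate; ∷-injective)
  open import Data.List.Relation.Unary.All as All using (All; []; _∷_)
  open import Data.List.Relation.Unary.AllPairs using ([]; _∷_)
  open import Data.List.Relation.Unary.Any using (here; there)
  open import Data.List.Relation.Unary.Unique.Propositional using (Unique)
  import Data.List.Relation.Unary.Unique.Propositional.Properties as Unique
  open import Data.List.Membership.Propositional using (_∈_)
  open import Data.List.Membership.Propositional.Properties using (∈-map⁻; ∈-++⁻)
  open import Data.Product using (_×_; _,_; proj₁; proj₂)
  open import Data.Sum using (inj₁; inj₂)
  open import Function.Base using (_∘_)
  open import Relation.Nullary using (¬_; contradiction)
  open import Relation.Binary.PropositionalEquality

  module _ {A : Set} where

    removeMember : ∀ {x : A} {ys} → x ∈ ys → List A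
    removeMember {ys = _ ∷ ys} (here _)  = ys
    removeMember {ys = y ∷ ys} (there p) = y ∷ removeMember p

    length-removeMember : ∀ {x : A} {ys} (p : x ∈ ys) → suc (length (removeMember p)) ≡ length ys
    length-removeMember (here _)  = refl
    length-removeMember (there p) = cong suc (length-removeMember p)

    ∈-removeMember : ∀ {x z : A} {ys} (p : x ∈ ys) → z ∈ ys → z ≢ x → z ∈ removeMember p
    ∈-removeMember (here refl) (here refl) z≢x = contradiction refl z≢x
    ∈-removeMember (here refl) (there q)   _   = q
    ∈-removeMember (there p)   (here refl) _   = here refl
    ∈-removeMember (there p)   (there q)   z≢x = there (∈-removeMember p q z≢x)

    Unique-⊆⇒length≤ : ∀ {xs ys : List A} → Unique xs → (∀ {z} → z ∈ xs → z ∈ ys) → length xs ≤ length ys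
    Unique-⊆⇒length≤ {[]}     _          _  = z≤n
    Unique-⊆⇒length≤ {x ∷ xs} (x∉xs ∷ u) xs⊆ys =
      subst (suc (length xs) ≤_) (length-removeMember x∈ys)
        (s≤s (Unique-⊆⇒length≤ u λ z∈xs → ∈-removeMember x∈ys (xs⊆ys (there z∈xs)) λ { refl → All.lookup x∉xs z∈xs refl }))
      where x∈ys = xs⊆ys (here refl)

  module _ {A B : Set} (f : A → B) where

    Unique-map⁺ : ∀ {xs : List A} → Unique xs → (∀ {x y} → x ∈ xs → y ∈ xs → f x ≡ f y → x ≡ y) →
                  Unique (map f xs)
    Unique-map⁺ {[]}     _          _        = []
    Unique-map⁺ {x ∷ xs} (x∉xs ∷ u) injective =
      All.tabulate fx≢ ∷ Unique-map⁺ u λ x∈ y∈ → injective (there x∈) (there y∈)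
      where
      fx≢ : ∀ {z} → z ∈ map f xs → f x ≢ z
      fx≢ z∈ fx≡z with ∈-map⁻ f z∈
      ... | y , y∈xs , refl = All.lookup x∉xs y∈xs (injective (here refl) (there y∈xs) fx≡z)

  map-≡⇒≡ : ∀ {A B : Set} {g g′ : A → B} {xs x} → map g xs ≡ map g′ xs → x ∈ xs → g x ≡ g′ x
  map-≡⇒≡ {xs = _ ∷ _} eq (here refl) = proj₁ (∷-injective eq)
  map-≡⇒≡ {xs = _ ∷ _} eq (there x∈)  = map-≡⇒≡ (proj₂ (∷-injective eq)) x∈

  bump : List ℕ → List ℕ
  bump []       = []
  bump (e ∷ es) = suc e ∷ es

  compositions : ℕ → ℕ → List (List ℕ)
  compositions zero    r       = [] ∷ []
  compositions (suc d) zero    = replicate (suc d) 0 ∷ []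
  compositions (suc d) (suc r) = map (0 ∷_) (compositions d (suc r)) ++ map bump (compositions (suc d) r)

  length-compositions : ∀ d r → length (compositions d r) ≡ (r + d) C d
  length-compositions zero    r       = refl
  length-compositions (suc d) zero    = sym (nCn≡1 (suc d))
  length-compositions (suc d) (suc r) = begin
    length (map (0 ∷_) (compositions d (suc r)) ++ map bump (compositions (suc d) r))
      ≡⟨ length-++ (map (0 ∷_) (compositions d (suc r))) ⟩
    length (map (0 ∷_) (compositions d (suc r))) + length (map bump (compositions (suc d) r))
      ≡⟨ cong₂ _+_ (length-map (0 ∷_) (compositions d (suc r))) (length-map bump (compositions (suc d) r)) ⟩
    length (compositions d (suc r)) + length (compositions (suc d) r)
      ≡⟨ cong₂ _+_ (length-compositions d (suc r)) (length-compositions (suc d) r) ⟩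
    (suc r + d) C d + (r + suc d) C suc d
      ≡⟨ cong (λ m → m C d + (r + suc d) C suc d) (+-suc r d) ⟨
    (r + suc d) C d + (r + suc d) C suc d
      ≡⟨ nCk+nC[k+1]≡[n+1]C[k+1] (r + suc d) d ⟩
    (suc r + suc d) C suc d ∎
    where open ≡-Reasoning

  ∈-compositions⇒ : ∀ d r {es} → es ∈ compositions d r → length es ≡ d × sum es ≤ r
  ∈-compositions⇒ zero    r       (here refl) = refl , z≤n
  ∈-compositions⇒ (suc d) zero    (here refl) = length-replicate (suc d) , ≤-reflexive (sum-zeros (suc d))
    where
    sum-zeros : ∀ n → sum (replicate n 0) ≡ 0
    sum-zeros zero    = refl
    sum-zeros (suc n) = sum-zeros n
  ∈-compositions⇒ (suc d) (suc r) es∈ with ∈-++⁻ (map (0 ∷_) (compositions d (suc r))) es∈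
  ... | inj₁ es∈₁ with ∈-map⁻ (0 ∷_) es∈₁
  ...   | es′ , es′∈ , refl = let |es′| , Σes′ = ∈-compositions⇒ d (suc r) es′∈ in cong suc |es′| , Σes′
  ∈-compositions⇒ (suc d) (suc r) es∈ | inj₂ es∈₂ with ∈-map⁻ bump es∈₂
  ...   | es′ , es′∈ , refl = bumped es′ (∈-compositions⇒ (suc d) r es′∈)
    where
    bumped : ∀ xs → length xs ≡ suc d × sum xs ≤ r → length (bump xs) ≡ suc d × sum (bump xs) ≤ suc r
    bumped (_ ∷ _) (|xs| , Σxs) = |xs| , s≤s Σxs

  bump-injective : ∀ {xs ys} → bump xs ≡ bump ys → xs ≡ ys
  bump-injective {[]}    {[]}    _  = refl
  bump-injective {x ∷ xs} {y ∷ ys} eq with ∷-injective eq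
  ... | sx≡sy , xs≡ys = cong₂ _∷_ (suc-injective sx≡sy) xs≡ys

  compositions-unique : ∀ d r → Unique (compositions d r)
  compositions-unique zero    r       = [] ∷ []
  compositions-unique (suc d) zero    = [] ∷ []
  compositions-unique (suc d) (suc r) = Unique.++⁺
    (Unique.map⁺ (proj₂ ∘ ∷-injective) (compositions-unique d (suc r)))
    (Unique.map⁺ bump-injective (compositions-unique (suc d) r))
    disjoint
    where
    disjoint : ∀ {es} → ¬ (es ∈ map (0 ∷_) (compositions d (suc r)) × es ∈ map bump (compositions (suc d) r))
    disjoint (es∈₁ , es∈₂) with ∈-map⁻ (0 ∷_) es∈₁ | ∈-map⁻ bump es∈₂
    ... | _ , _ , refl | e ∷ _ , _ , ()

module Elimination where

  open import Data.Nat as ℕ using (ℕ; zero; suc; _<_; _≤_; z≤n; _⊓_)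
  open import Data.Nat.Properties as ℕ using (m≤n⇒m<n∨m≡n; n<1+n; m<n⇒m<1+n; suc-injective; ⊓-idem)
  open import Data.Integer using (ℤ; +_; _+_; _*_; -_; _-_; _≟_)
  open import Data.Integer.Properties using (+-injective; i*j≡0⇒i≡0∨j≡0; i-j≡0⇒i≡j; i≡j⇒i-j≡0; +-identityˡ; +-identityʳ)
  open import Data.Integer.Tactic.RingSolver using (solve-∀)
  open import Data.List using (List; []; _∷_; length; map; zipWith)
  open import Data.List.Properties using (length-zipWith)
  open import Data.List.Relation.Unary.All as All using (All; []; _∷_; all?)
  open import Data.List.Relation.Unary.All.Properties using (¬All⇒Any¬)
  open import Data.List.Relation.Unary.Any using (here; there)
  open import Data.List.Membership.Propositional using (_∈_; find)
  open import Data.Product using (_,_)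
  open import Data.Sum using (inj₁; inj₂)
  open import Function.Base using (_∘_)
  open import Relation.Nullary using (¬_; yes; no; contradiction)
  open import Relation.Binary.PropositionalEquality

  Vector : Set
  Vector = ℕ → ℤ

  data Descending : ℕ → List ℕ → Set where
    []  : ∀ {b} → Descending b []
    _∷_ : ∀ {b c cs} → c < b → Descending c cs → Descending b (c ∷ cs)

  Descending-weaken : ∀ {b cs} → Descending b cs → Descending (suc b) cs
  Descending-weaken []         = []
  Descending-weaken (c<b ∷ cs) = m<n⇒m<1+n c<b ∷ cs

  combination : ∀ {A : Set} → (A → Vector) → List ℤ → List A → Vector
  combination f (α ∷ αs) (a ∷ as) q = α * f a q + combination f αs as q
  combination f _        _        q = + 0

  Independent : ∀ {A : Set} → (A → Vector) → List A → Set
  Independent f as = ∀ αs → length αs ≡ length as → (∀ q → combination f αs as q ≡ + 0) → All (_≡ + 0) αs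

  -- Elimination over ℤ without division: v is scaled by the pivot g n before v n · g is subtracted.
  clear : ℕ → Vector → Vector → Vector
  clear n g v q = g n * v q - v n * g q

  clear-self : ∀ n g v → clear n g v n ≡ + 0
  clear-self n g v = cancel (g n) (v n)
    where
    cancel : ∀ x y → x * y - y * x ≡ + 0
    cancel = solve-∀

  clear≡0-if-v≡0 : ∀ n g v q → v q ≡ + 0 → v n ≡ + 0 → clear n g v q ≡ + 0
  clear≡0-if-v≡0 n g v q v[q]≡0 v[n]≡0 = trans (cong₂ (λ y z → g n * y - z * g q) v[q]≡0 v[n]≡0) (vanish (g n) (g q))
    where
    vanish : ∀ x y → x * + 0 - + 0 * y ≡ + 0
    vanish = solve-∀

  clear≡0-if-column≡0 : ∀ n g v q → g q ≡ + 0 → v q ≡ + 0 → clear n g v q ≡ + 0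
  clear≡0-if-column≡0 n g v q g[q]≡0 v[q]≡0 = trans (cong₂ (λ y z → g n * y - v n * z) v[q]≡0 g[q]≡0) (vanish (g n) (v n))
    where
    vanish : ∀ x y → x * + 0 - y * + 0 ≡ + 0
    vanish = solve-∀

  combination-clear : ∀ {A : Set} n g (f : A → Vector) αs as q →
    combination (clear n g ∘ f) αs as q ≡ clear n g (combination f αs as) q
  combination-clear n g f []       as       q = sym (clear≡0-if-v≡0 n g _ q refl refl)
  combination-clear n g f (α ∷ αs) []       q = sym (clear≡0-if-v≡0 n g _ q refl refl)
  combination-clear n g f (α ∷ αs) (a ∷ as) q =
    trans (cong (λ y → α * clear n g (f a) q + y) (combination-clear n g f αs as q))
          (distribute (g n) (g q) α (f a q) (f a n) (combination f αs as q) (combination f αs as n))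
    where
    distribute : ∀ x y α u v w z → α * (x * u - v * y) + (x * w - z * y) ≡ x * (α * u + w) - (α * v + z) * y
    distribute = solve-∀

  combination-zeros : ∀ {A : Set} (f : A → Vector) αs as → All (_≡ + 0) αs → ∀ q → combination f αs as q ≡ + 0
  combination-zeros f []           as       _            q = refl
  combination-zeros f (α ∷ αs)     []       _            q = refl
  combination-zeros f (.(+ 0) ∷ αs) (a ∷ as) (refl ∷ αs≡0) q = trans (+-identityˡ _) (combination-zeros f αs as αs≡0 q)

  clear-injective : ∀ n g u v q → g n ≢ + 0 → u n ≡ v n → clear n g u q ≡ clear n g v q → u q ≡ v q
  clear-injective n g u v q x≢0 u[n]≡v[n] cleared≡ = i-j≡0⇒i≡j (u q) (v q) (cancel (begin
    g n * (u q - v q)                             ≡⟨ split (g n) (u q) (v q) (u n * g q) ⟩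
    (g n * u q - u n * g q) - (g n * v q - u n * g q)
      ≡⟨ cong (λ z → (g n * u q - u n * g q) - (g n * v q - z * g q)) u[n]≡v[n] ⟩
    clear n g u q - clear n g v q                 ≡⟨ i≡j⇒i-j≡0 cleared≡ ⟩
    + 0                                           ∎))
    where
    open ≡-Reasoning
    split : ∀ x y z w → x * (y - z) ≡ (x * y - w) - (x * z - w)
    split = solve-∀
    cancel : ∀ {y} → g n * y ≡ + 0 → y ≡ + 0
    cancel xy≡0 with i*j≡0⇒i≡0∨j≡0 (g n) xy≡0
    ... | inj₁ x≡0 = contradiction x≡0 x≢0
    ... | inj₂ y≡0 = y≡0

  module _ {A : Set} where

    record EchelonBasis (n : ℕ) (f : A → Vector) (L : List A) : Set where
      field
        pivots         : List ℕ
        basis          : List A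
        descending     : Descending n pivots
        pivotColumns≢0 : All (λ c → ¬ (∀ a → a ∈ L → f a c ≡ + 0)) pivots
        basis⊆         : All (_∈ L) basis
        length-basis   : length basis ≡ length pivots
        pivotsDetermine : ∀ {a b} → a ∈ L → b ∈ L → (∀ c → c ∈ pivots → f a c ≡ f b c) → ∀ q → f a q ≡ f b q
        independent    : Independent f basis

    SupportedBelow : ℕ → (A → Vector) → List A → Set
    SupportedBelow n f L = ∀ a → a ∈ L → ∀ q → n ≤ q → f a q ≡ + 0

    EchelonBasis-weaken : ∀ {n f L} → EchelonBasis n f L → EchelonBasis (suc n) f L
    EchelonBasis-weaken E = record
      { pivots = pivots ; basis = basis ; descending = Descending-weaken descending
      ; pivotColumns≢0 = pivotColumns≢0 ; basis⊆ = basis⊆ ; length-basis = length-basis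
      ; pivotsDetermine = pivotsDetermine ; independent = independent
      }
      where open EchelonBasis E

    Independent-clear : ∀ {n} {f : A → Vector} {g B} → f g n ≢ + 0 →
      Independent (clear n (f g) ∘ f) B → Independent f (g ∷ B)
    Independent-clear {n} {f} {g} {B} x≢0 independent (β ∷ αs) |αs|≡ comb≡0 = β≡0 ∷ αs≡0
      where
      x = f g n
      S = combination f αs B
      S≡ : ∀ q → S q ≡ - (β * f g q)
      S≡ q = i-j≡0⇒i≡j (S q) _ (trans (rearrange (β * f g q) (S q)) (comb≡0 q))
        where
        rearrange : ∀ y z → z - - y ≡ y + z
        rearrange = solve-∀
      αs≡0 : All (_≡ + 0) αs
      αs≡0 = independent αs (suc-injective |αs|≡) λ q → begin
        combination (clear n (f g) ∘ f) αs B q ≡⟨ combination-clear n (f g) f αs B q ⟩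
        x * S q - S n * f g q                  ≡⟨ cong₂ (λ y z → x * y - z * f g q) (S≡ q) (S≡ n) ⟩
        x * - (β * f g q) - - (β * x) * f g q  ≡⟨ cancels x β (f g q) ⟩
        + 0                                     ∎
        where
        open ≡-Reasoning
        cancels : ∀ x β y → x * - (β * y) - - (β * x) * y ≡ + 0
        cancels = solve-∀
      β≡0 : β ≡ + 0
      β≡0 with i*j≡0⇒i≡0∨j≡0 β (trans (sym (+-identityʳ (β * x)))
                 (trans (cong (λ z → β * x + z) (sym (combination-zeros f αs B αs≡0 n))) (comb≡0 n)))
      ... | inj₁ β≡0 = β≡0
      ... | inj₂ x≡0 = contradiction x≡0 x≢0

    echelonBasis-pivot : ∀ {n f L g} → g ∈ L → f g n ≢ + 0 →
      EchelonBasis n (clear n (f g) ∘ f) L → EchelonBasis (suc n) f L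
    echelonBasis-pivot {n} {f} {L} {g} g∈L x≢0 E = record
      { pivots          = n ∷ pivots
      ; basis           = g ∷ basis
      ; descending      = n<1+n n ∷ descending
      ; pivotColumns≢0  = (λ column≡0 → x≢0 (column≡0 g g∈L)) ∷ All.map nonzero pivotColumns≢0
      ; basis⊆          = g∈L ∷ basis⊆
      ; length-basis    = cong suc length-basis
      ; pivotsDetermine = λ {a} {b} a∈L b∈L agree q → clear-injective n (f g) (f a) (f b) q x≢0
                            (agree n (here refl)) (pivotsDetermine a∈L b∈L (clear-agree agree) q)
      ; independent     = Independent-clear {n} {f} {g} x≢0 independent
      }
      where
      open EchelonBasis E
      nonzero : ∀ {c} → ¬ (∀ a → a ∈ L → clear n (f g) (f a) c ≡ + 0) → ¬ (∀ a → a ∈ L → f a c ≡ + 0)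
      nonzero {c} cleared≢0 column≡0 =
        cleared≢0 λ a a∈L → clear≡0-if-column≡0 n (f g) (f a) c (column≡0 g g∈L) (column≡0 a a∈L)
      clear-agree : ∀ {a b} → (∀ c → c ∈ n ∷ pivots → f a c ≡ f b c) →
        ∀ c → c ∈ pivots → clear n (f g) (f a) c ≡ clear n (f g) (f b) c
      clear-agree agree c c∈ = cong₂ (λ y z → f g n * y - z * f g c) (agree c (there c∈)) (agree n (here refl))

    SupportedBelow-lower : ∀ {n f L} → SupportedBelow (suc n) f L → (∀ a → a ∈ L → f a n ≡ + 0) →
      SupportedBelow n f L
    SupportedBelow-lower supported column≡0 a a∈L q n≤q with m≤n⇒m<n∨m≡n n≤q
    ... | inj₁ n<q  = supported a a∈L q n<q
    ... | inj₂ refl = column≡0 a a∈L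

    SupportedBelow-clear : ∀ {n f L g} → SupportedBelow (suc n) f L → g ∈ L →
      SupportedBelow n (clear n (f g) ∘ f) L
    SupportedBelow-clear {n} {f} {g = g} supported g∈L a a∈L q n≤q with m≤n⇒m<n∨m≡n n≤q
    ... | inj₁ n<q  = clear≡0-if-column≡0 n (f g) (f a) q (supported g g∈L q n<q) (supported a a∈L q n<q)
    ... | inj₂ refl = clear-self n (f g) (f a)

    echelonBasis : ∀ n (f : A → Vector) L → SupportedBelow n f L → EchelonBasis n f L
    echelonBasis zero f L supported = record
      { pivots = [] ; basis = [] ; descending = [] ; pivotColumns≢0 = [] ; basis⊆ = [] ; length-basis = refl
      ; pivotsDetermine = λ a∈L b∈L _ q → trans (supported _ a∈L q z≤n) (sym (supported _ b∈L q z≤n))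
      ; independent = λ { [] _ _ → [] }
      }
    echelonBasis (suc n) f L supported with all? (λ a → f a n ≟ + 0) L
    ... | yes column≡0 =
      EchelonBasis-weaken (echelonBasis n f L (SupportedBelow-lower supported λ a → All.lookup column≡0))
    ... | no column≢0 with find (¬All⇒Any¬ (λ a → f a n ≟ + 0) L column≢0)
    ...   | g , g∈L , f[g][n]≢0 =
      echelonBasis-pivot g∈L f[g][n]≢0 (echelonBasis n (clear n (f g) ∘ f) L (SupportedBelow-clear supported g∈L))

  module _ {A : Set} (f : A → Vector) where

    combination-zipWith-∸ : ∀ es es′ as → length es ≡ length es′ → ∀ q →
      combination f (zipWith (λ e e′ → + e - + e′) es es′) as q ≡
      combination f (map +_ es) as q - combination f (map +_ es′) as q
    combination-zipWith-∸ []       []         as       _     q = refl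
    combination-zipWith-∸ (e ∷ es) (e′ ∷ es′) []       _     q = refl
    combination-zipWith-∸ (e ∷ es) (e′ ∷ es′) (a ∷ as) |es| q =
      trans (cong (λ z → (+ e - + e′) * f a q + z) (combination-zipWith-∸ es es′ as (suc-injective |es|) q))
            (distribute (+ e) (+ e′) (f a q) (combination f (map +_ es) as q) (combination f (map +_ es′) as q))
      where
      distribute : ∀ x y z u v → (x - y) * z + (u - v) ≡ (x * z + u) - (y * z + v)
      distribute = solve-∀

    Independent⇒injective : ∀ {as} → Independent f as → ∀ {es es′} → length es ≡ length as → length es′ ≡ length as →
      (∀ q → combination f (map +_ es) as q ≡ combination f (map +_ es′) as q) → es ≡ es′
    Independent⇒injective {as} independent {es} {es′} |es| |es′| same =
      differences≡0⇒≡ es es′ |es|≡|es′| (independent _ |differences|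
        λ q → trans (combination-zipWith-∸ es es′ as |es|≡|es′| q) (i≡j⇒i-j≡0 (same q)))
      where
      |es|≡|es′| = trans |es| (sym |es′|)
      |differences| : length (zipWith (λ e e′ → + e - + e′) es es′) ≡ length as
      |differences| = begin
        length (zipWith _ es es′)   ≡⟨ length-zipWith _ es es′ ⟩
        length es ⊓ length es′      ≡⟨ cong (length es ⊓_) |es|≡|es′| ⟨
        length es ⊓ length es       ≡⟨ ⊓-idem (length es) ⟩
        length es                   ≡⟨ |es| ⟩
        length as                   ∎
        where open ≡-Reasoning
      differences≡0⇒≡ : ∀ xs ys → length xs ≡ length ys → All (_≡ + 0) (zipWith (λ e e′ → + e - + e′) xs ys) → xs ≡ ys
      differences≡0⇒≡ []       []       _ _            = refl
      differences≡0⇒≡ (x ∷ xs) (y ∷ ys) l (x-y≡0 ∷ rest) =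
        cong₂ _∷_ (+-injective (i-j≡0⇒i≡j (+ x) (+ y) x-y≡0)) (differences≡0⇒≡ xs ys (suc-injective l) rest)

module SmallPrimes where

  open import Data.Nat
  open import Data.Nat.Properties
  open import Data.Nat.Primality using (Prime; prime?)
  open import Data.List using (List; []; _∷_; length; upTo)
  open import Data.List.Relation.Unary.All as All using (All; []; _∷_)
  open import Data.List.Relation.Unary.Any using (here; there)
  open import Data.List.Relation.Binary.Pointwise using (Pointwise; []; _∷_)
  open import Data.List.Membership.Propositional using (_∈_)
  open import Data.List.Membership.Propositional.Properties using (∈-filter⁻; ∈-upTo⁻)
  import Data.List.Relation.Unary.Unique.Propositional.Properties as Unique
  open import Data.Product using (Σ; _×_; _,_; proj₁; proj₂)
  open import Data.Sum using (inj₁; inj₂)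
  open import Relation.Nullary using (¬_; yes; no; contradiction)
  open import Relation.Unary using (Decidable)
  open import Relation.Binary.PropositionalEquality
  open import Defs using (primePi)
  open Valuation using (prime⇒≥2)
  open Elimination using (Descending; []; _∷_)
  open Counting using (Unique-⊆⇒length≤)

  LeastAbove : (ℕ → Set) → ℕ → ℕ → ℕ → Set
  LeastAbove P a c m = P m × a < m × m ≤ c × (∀ q → a < q → q < m → ¬ P q)

  leastAbove : ∀ {P : ℕ → Set} → Decidable P → ∀ a g → P (suc a + g) → Σ ℕ (LeastAbove P a (suc a + g))
  leastAbove P? a g P[c] with P? (suc a)
  ... | yes P[a+1] = suc a , P[a+1] , ≤-refl , m≤m+n (suc a) g , λ q a<q q≤a _ → <⇒≱ a<q (≤-pred q≤a)
  leastAbove {P} P? a zero P[c] | no ¬P[a+1] = contradiction (subst P (+-identityʳ (suc a)) P[c]) ¬P[a+1]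
  leastAbove {P} P? a (suc g) P[c] | no ¬P[a+1]
    with leastAbove P? (suc a) g (subst P (+-suc (suc a) g) P[c])
  ... | m , P[m] , a+1<m , m≤c , least =
    m , P[m] , <-trans (n<1+n a) a+1<m , subst (m ≤_) (sym (+-suc (suc a) g)) m≤c , least′
    where
    least′ : ∀ q → a < q → q < m → ¬ P q
    least′ q a<q q<m with m≤n⇒m<n∨m≡n a<q
    ... | inj₁ a+1<q = least q a+1<q q<m
    ... | inj₂ refl  = ¬P[a+1]

  -- top [] = 1 makes containsSmaller vacuous for the empty list.
  top : List ℕ → ℕ
  top []      = 1
  top (x ∷ _) = x

  record InitialPrimes (b : ℕ) (C : List ℕ) : Set where
    field
      primes          : List ℕ
      descending      : Descending b primes
      allPrime        : All Prime primes
      pointwise≤      : Pointwise _≤_ primes C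
      containsSmaller : ∀ q → Prime q → q ≤ top primes → q ∈ primes

  top<bound : ∀ {b xs} → Descending b xs → 1 < b → top xs < b
  top<bound []        1<b = 1<b
  top<bound (x<b ∷ _) _   = x<b

  Descending-rebound : ∀ {b b′ xs} → Descending b xs → top xs < b′ → Descending b′ xs
  Descending-rebound []       _      = []
  Descending-rebound (_ ∷ xs) x<b′ = x<b′ ∷ xs

  ∈⇒≤top : ∀ {b xs x} → Descending b xs → x ∈ xs → x ≤ top xs
  ∈⇒≤top (_ ∷ _)         (here refl) = ≤-refl
  ∈⇒≤top {x = x} (_ ∷ xs) (there x∈)  = <⇒≤ (below xs x∈)
    where
    below : ∀ {c ys} → Descending c ys → x ∈ ys → x < c
    below (y<c ∷ _)  (here refl) = y<c
    below (y<c ∷ ys) (there x∈)  = <-trans (below ys x∈) y<c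

  initialPrimes : ∀ {b} C → Descending b C → All Prime C → InitialPrimes b C
  initialPrimes [] _ _ = record
    { primes = [] ; descending = [] ; allPrime = [] ; pointwise≤ = []
    ; containsSmaller = λ q pq q≤1 → contradiction (≤-trans (prime⇒≥2 pq) q≤1) λ { (s≤s ()) } }
  initialPrimes (c ∷ C) (c<b ∷ C<c) (prime[c] ∷ prime[C]) = record
    { primes          = P ∷ I.primes
    ; descending      = <-≤-trans (s≤s P≤c) c<b ∷ Descending-rebound I.descending a<P
    ; allPrime        = prime[P] ∷ I.allPrime
    ; pointwise≤      = P≤c ∷ I.pointwise≤
    ; containsSmaller = containsSmaller
    }
    where
    module I = InitialPrimes (initialPrimes C C<c prime[C])
    a = top I.primes
    a<c : a < c
    a<c = top<bound I.descending (prime⇒≥2 prime[c])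
    next : Σ ℕ (LeastAbove Prime a (suc a + (c ∸ suc a)))
    next = leastAbove prime? a (c ∸ suc a) (subst Prime (sym (m+[n∸m]≡n a<c)) prime[c])
    P = proj₁ next
    prime[P] = proj₁ (proj₂ next)
    a<P = proj₁ (proj₂ (proj₂ next))
    P≤c : P ≤ c
    P≤c = subst (P ≤_) (m+[n∸m]≡n a<c) (proj₁ (proj₂ (proj₂ (proj₂ next))))
    containsSmaller : ∀ q → Prime q → q ≤ P → q ∈ P ∷ I.primes
    containsSmaller q prime[q] q≤P with m≤n⇒m<n∨m≡n q≤P
    ... | inj₂ refl = here refl
    ... | inj₁ q<P with q ≤? a
    ...   | yes q≤a = there (I.containsSmaller q prime[q] q≤a)
    ...   | no  q≰a = contradiction prime[q] (proj₂ (proj₂ (proj₂ (proj₂ next))) q (≰⇒> q≰a) q<P)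

  primePi≤length : ∀ {b C} (I : InitialPrimes b C) → ∀ {P} → P ∈ InitialPrimes.primes I →
    primePi P ≤ length (InitialPrimes.primes I)
  primePi≤length I {P} P∈ = Unique-⊆⇒length≤ (Unique.filter⁺ prime? (Unique.upTo⁺ (suc P))) λ {z} z∈ →
    let z∈upTo , prime[z] = ∈-filter⁻ prime? {xs = upTo (suc P)} z∈
    in containsSmaller z prime[z] (≤-trans (≤-pred (∈-upTo⁻ z∈upTo)) (∈⇒≤top descending P∈))
    where open InitialPrimes I

module PowerProducts where

  open import Data.Nat
  open import Data.Nat.Properties
  open import Data.Nat.Divisibility
  open import Data.Nat.Primality
  open import Data.Nat.ListAction using (sum)
  open import Data.List using (List; []; _∷_; length; map)
  open import Data.List.Relation.Unary.All as All using (All; []; _∷_)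
  open import Data.List.Relation.Binary.Pointwise using (Pointwise; []; _∷_)
  open import Data.List.Membership.Propositional using (_∈_)
  open import Data.List.Membership.DecPropositional _≟_ using (_∈?_)
  open import Data.List.Relation.Unary.All.Properties using (¬Any⇒All¬)
  open import Relation.Nullary using (yes; no; contradiction)
  open import Relation.Binary.PropositionalEquality
  open Valuation
  open Elimination using (Descending; []; _∷_)

  powerProduct : List ℕ → List ℕ → ℕ
  powerProduct (Q ∷ Qs) (e ∷ es) = Q ^ e * powerProduct Qs es
  powerProduct _        _        = 1

  valuationsAt : List ℕ → ℕ → List ℕ
  valuationsAt C h = map (λ c → valuation c h) C

  powerProduct≥1 : ∀ {Qs} → All (1 ≤_) Qs → ∀ es → 1 ≤ powerProduct Qs es
  powerProduct≥1 []         es       = s≤s z≤n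
  powerProduct≥1 (_ ∷ _)    []       = s≤s z≤n
  powerProduct≥1 (1≤Q ∷ Qs) (e ∷ es) = 1≤*1≤ (1≤^ e 1≤Q) (powerProduct≥1 Qs es)

  primes≥1 : ∀ {Qs} → All Prime Qs → All (1 ≤_) Qs
  primes≥1 = All.map prime⇒≥1

  Descending⇒All< : ∀ {b Qs} → Descending b Qs → All (_< b) Qs
  Descending⇒All< []         = []
  Descending⇒All< (Q<b ∷ Qs) = Q<b ∷ All.map (λ x<Q → <-trans x<Q Q<b) (Descending⇒All< Qs)

  valuation-powerProduct∷ : ∀ {r Q Qs} → Prime r → Prime Q → All Prime Qs → ∀ e es →
    valuation r (powerProduct (Q ∷ Qs) (e ∷ es)) ≡ valuation r (Q ^ e) + valuation r (powerProduct Qs es)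
  valuation-powerProduct∷ pr pQ pQs e es = valuation-* pr (1≤^ e (prime⇒≥1 pQ)) (powerProduct≥1 (primes≥1 pQs) es)

  valuation-powerProduct-∉ : ∀ {r Qs} → Prime r → All Prime Qs → All (r ≢_) Qs → ∀ es →
    valuation r (powerProduct Qs es) ≡ 0
  valuation-powerProduct-∉ pr []         _           es       = valuation-1 pr
  valuation-powerProduct-∉ pr (_ ∷ _)    _           []       = valuation-1 pr
  valuation-powerProduct-∉ pr (pQ ∷ pQs) (r≢Q ∷ r∉) (e ∷ es) = begin
    _ ≡⟨ valuation-powerProduct∷ pr pQ pQs e es ⟩
    _ ≡⟨ cong₂ _+_ (valuation-other^ pr pQ r≢Q e) (valuation-powerProduct-∉ pr pQs r∉ es) ⟩
    0 ∎
    where open ≡-Reasoning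

  valuation-powerProduct-head : ∀ {b Q Qs} → Descending b (Q ∷ Qs) → All Prime (Q ∷ Qs) → ∀ e es →
    valuation Q (powerProduct (Q ∷ Qs) (e ∷ es)) ≡ e
  valuation-powerProduct-head {Q = Q} (_ ∷ Qs<Q) (pQ ∷ pQs) e es = begin
    _     ≡⟨ valuation-powerProduct∷ pQ pQ pQs e es ⟩
    _     ≡⟨ cong₂ _+_ (valuation-self^ pQ e) (valuation-powerProduct-∉ pQ pQs Q∉Qs es) ⟩
    e + 0 ≡⟨ +-identityʳ e ⟩
    e     ∎
    where
    open ≡-Reasoning
    Q∉Qs = All.map (λ x<Q Q≡x → <-irrefl (sym Q≡x) x<Q) (Descending⇒All< Qs<Q)

  powerProduct-injective : ∀ {b Qs} → Descending b Qs → All Prime Qs → ∀ {es es′} →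
    length es ≡ length Qs → length es′ ≡ length Qs → powerProduct Qs es ≡ powerProduct Qs es′ → es ≡ es′
  powerProduct-injective []       []  {[]}     {[]}       _ _ _ = refl
  powerProduct-injective {Qs = Q ∷ Qs} desc@(_ ∷ Qs<Q) primes@(pQ ∷ pQs) {e ∷ es} {e′ ∷ es′} |es| |es′| eq =
    cong₂ _∷_ e≡e′ (powerProduct-injective Qs<Q pQs (suc-injective |es|) (suc-injective |es′|) tails≡)
    where
    e≡e′ : e ≡ e′
    e≡e′ = trans (sym (valuation-powerProduct-head desc primes e es))
                 (trans (cong (valuation Q) eq) (valuation-powerProduct-head desc primes e′ es′))
    tails≡ : powerProduct Qs es ≡ powerProduct Qs es′
    tails≡ = *-cancelˡ-≡ _ _ (Q ^ e′) {{m^n≢0 Q e′ {{prime⇒nonZero pQ}}}}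
               (subst (λ x → Q ^ x * powerProduct Qs es ≡ _) e≡e′ eq)

  powerProduct-mono : ∀ {Ps C} → Pointwise _≤_ Ps C → ∀ es → powerProduct Ps es ≤ powerProduct C es
  powerProduct-mono []          es       = ≤-refl
  powerProduct-mono (_ ∷ _)     []       = ≤-refl
  powerProduct-mono (P≤c ∷ Ps≤) (e ∷ es) = *-mono-≤ (^-monoˡ-≤ e P≤c) (powerProduct-mono Ps≤ es)

  powerProduct≤^sum : ∀ {k Qs} → 1 ≤ k → All (_≤ k) Qs → ∀ es → powerProduct Qs es ≤ k ^ sum es
  powerProduct≤^sum 1≤k []         es       = 1≤^ (sum es) 1≤k
  powerProduct≤^sum 1≤k (_ ∷ _)    []       = s≤s z≤n
  powerProduct≤^sum {k} 1≤k (Q≤k ∷ Qs≤k) (e ∷ es) = begin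
    _                   ≤⟨ *-mono-≤ (^-monoˡ-≤ e Q≤k) (powerProduct≤^sum 1≤k Qs≤k es) ⟩
    k ^ e * k ^ sum es  ≡⟨ ^-distribˡ-+-* k e (sum es) ⟨
    k ^ (e + sum es)    ∎
    where open ≤-Reasoning

  valuation-powerProduct-valuationsAt≤ : ∀ {b C h} → Descending b C → All Prime C → 1 ≤ h →
    ∀ r → Prime r → valuation r (powerProduct C (valuationsAt C h)) ≤ valuation r h
  valuation-powerProduct-valuationsAt≤ {h = h} [] [] 1≤h r pr = subst (_≤ valuation r h) (sym (valuation-1 pr)) z≤n
  valuation-powerProduct-valuationsAt≤ {C = c ∷ C} {h} desc@(_ ∷ C<c) primes@(pc ∷ pC) 1≤h r pr with r ≟ c
  ... | yes refl = ≤-reflexive (valuation-powerProduct-head desc primes (valuation r h) (valuationsAt C h))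
  ... | no  r≢c = begin
    _ ≡⟨ valuation-powerProduct∷ pr pc pC (valuation c h) (valuationsAt C h) ⟩
    _ ≡⟨ cong (_+ _) (valuation-other^ pr pc r≢c (valuation c h)) ⟩
    _ ≤⟨ valuation-powerProduct-valuationsAt≤ C<c pC 1≤h r pr ⟩
    _ ∎
    where open ≤-Reasoning

  powerProduct-valuationsAt∣ : ∀ {b C h} → Descending b C → All Prime C → 1 ≤ h → powerProduct C (valuationsAt C h) ∣ h
  powerProduct-valuationsAt∣ {C = C} {h} desc primes 1≤h =
    valuations≤⇒∣ _ h (powerProduct≥1 (primes≥1 primes) (valuationsAt C h)) 1≤h
      (valuation-powerProduct-valuationsAt≤ desc primes 1≤h)

  prime∣powerProduct⇒∈ : ∀ {Qs q} → All Prime Qs → Prime q → ∀ es → q ∣ powerProduct Qs es → q ∈ Qs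
  prime∣powerProduct⇒∈ {Qs} {q} primes pq es q∣ with q ∈? Qs
  ... | yes q∈Qs = q∈Qs
  ... | no  q∉Qs = contradiction (valuation-powerProduct-∉ pq primes (¬Any⇒All¬ Qs q∉Qs) es)
                     (λ ν≡0 → <⇒≢ (∣⇒valuation≥1 pq (powerProduct≥1 (primes≥1 primes) es) q∣) (sym ν≡0))

module Congruences where

  open import Data.Nat as ℕ using (ℕ; zero; suc; NonZero; _⊓_; _∸_)
  import Data.Nat.Properties as ℕ
  open import Data.Nat.DivMod using (_%_; _/_; m≡m%n+[m/n]*n; m<n⇒m%n≡m; %-distribˡ-*; m%n%n≡m%n)
  open import Data.Nat.Tactic.RingSolver renaming (solve-∀ to ℕ-solve-∀)
  open import Data.Integer using (ℤ; +_; _+_; _*_; -_; _-_)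
  open import Data.Integer.Properties using (pos-*; pos-+; *-identityˡ; +-comm; +-identityˡ; m-n≡m⊖n; ⊖-≥)
  open import Data.Integer.Divisibility.Signed
  open import Data.Integer.Tactic.RingSolver using (solve-∀)
  open import Data.List using (List; _∷_; replicate)
  open import Data.Product using (Σ; _×_; _,_)
  open import Data.Sum using (_⊎_; inj₁; inj₂)
  open import Relation.Binary.PropositionalEquality
  open import Defs using (height; InG)
  open MonicRoots using (evalMonic; residues-≡)

  IsSign : ℤ → Set
  IsSign u = u ≡ + 1 ⊎ u ≡ - + 1

  IsSign-* : ∀ {u v} → IsSign u → IsSign v → IsSign (u * v)
  IsSign-* (inj₁ refl) (inj₁ refl) = inj₁ refl
  IsSign-* (inj₁ refl) (inj₂ refl) = inj₂ refl
  IsSign-* (inj₂ refl) (inj₁ refl) = inj₂ refl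
  IsSign-* (inj₂ refl) (inj₂ refl) = inj₁ refl

  infix 4 _≡±_[mod_]

  _≡±_[mod_] : ℕ → ℕ → ℕ → Set
  y ≡± m [mod p ] = Σ ℤ λ u → IsSign u × + p ∣ + y - u * + m

  ≡±-refl : ∀ {p m} → m ≡± m [mod p ]
  ≡±-refl {p} {m} = + 1 , inj₁ refl , subst (+ p ∣_) (sym (x-1*x (+ m))) (divides (+ 0) refl)
    where
    x-1*x : ∀ x → x - + 1 * x ≡ + 0
    x-1*x = solve-∀

  ≡±-* : ∀ {p y₁ y₂ m₁ m₂} → y₁ ≡± m₁ [mod p ] → y₂ ≡± m₂ [mod p ] → y₁ ℕ.* y₂ ≡± m₁ ℕ.* m₂ [mod p ]
  ≡±-* {p} {y₁} {y₂} {m₁} {m₂} (u₁ , ±u₁ , p∣₁) (u₂ , ±u₂ , p∣₂) =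
    u₁ * u₂ , IsSign-* ±u₁ ±u₂ , subst (+ p ∣_) (sym expand) (∣m∣n⇒∣m+n (∣n⇒∣m*n (+ y₁) p∣₂) (∣n⇒∣m*n (u₂ * + m₂) p∣₁))
    where
    split : ∀ a b c d u v → a * b - u * v * (c * d) ≡ a * (b - v * d) + v * d * (a - u * c)
    split = solve-∀
    expand : + (y₁ ℕ.* y₂) - u₁ * u₂ * + (m₁ ℕ.* m₂) ≡ + y₁ * (+ y₂ - u₂ * + m₂) + u₂ * + m₂ * (+ y₁ - u₁ * + m₁)
    expand = trans (cong₂ (λ a b → a - u₁ * u₂ * b) (pos-* y₁ y₂) (pos-* m₁ m₂)) (split (+ y₁) (+ y₂) (+ m₁) (+ m₂) u₁ u₂)

  ≡±-^ : ∀ {p y m} e → y ≡± m [mod p ] → y ℕ.^ e ≡± m ℕ.^ e [mod p ]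
  ≡±-^ zero    _     = ≡±-refl
  ≡±-^ (suc e) y≡±m = ≡±-* y≡±m (≡±-^ e y≡±m)

  ≡±-congˡ : ∀ {p y y′ m} → + p ∣ + y′ - + y → y ≡± m [mod p ] → y′ ≡± m [mod p ]
  ≡±-congˡ {p} {y} {y′} {m} p∣y′-y (u , ±u , p∣y-um) =
    u , ±u , subst (+ p ∣_) (telescope (+ y′) (+ y) (u * + m)) (∣m∣n⇒∣m+n p∣y′-y p∣y-um)
    where
    telescope : ∀ a b c → (a - b) + (b - c) ≡ a - c
    telescope = solve-∀

  %-congruent : ∀ p y .{{_ : NonZero p}} → + p ∣ + (y % p) - + y
  %-congruent p y = divides (- + (y / p)) (begin
    + (y % p) - + y                                ≡⟨ cong (λ z → + (y % p) - + z) (m≡m%n+[m/n]*n y p) ⟩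
    + (y % p) - + (y % p ℕ.+ y / p ℕ.* p)          ≡⟨ cong (λ z → + (y % p) - z) (pos-+ (y % p) _) ⟩
    + (y % p) - (+ (y % p) + + (y / p ℕ.* p))      ≡⟨ cong (λ z → + (y % p) - (+ (y % p) + z)) (pos-* (y / p) p) ⟩
    + (y % p) - (+ (y % p) + + (y / p) * + p)      ≡⟨ cancel (+ (y % p)) (+ (y / p)) (+ p) ⟩
    - + (y / p) * + p                              ∎)
    where
    open ≡-Reasoning
    cancel : ∀ r q p → r - (r + q * p) ≡ - q * p
    cancel = solve-∀

  ≡±-height : ∀ {p x} → x ℕ.≤ p → x ≡± height p x [mod p ]
  ≡±-height {p} {x} x≤p with ℕ.≤-total x (p ∸ x)
  ... | inj₁ x≤p-x rewrite ℕ.m≤n⇒m⊓n≡m x≤p-x = ≡±-refl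
  ... | inj₂ p-x≤x rewrite ℕ.m≥n⇒m⊓n≡n p-x≤x =
    - + 1 , inj₂ refl , divides (+ 1) (begin
      + x - - + 1 * + (p ∸ x) ≡⟨ negate (+ x) (+ (p ∸ x)) ⟩
      + x + + (p ∸ x)         ≡⟨ pos-+ x (p ∸ x) ⟨
      + (x ℕ.+ (p ∸ x))       ≡⟨ cong +_ (ℕ.m+[n∸m]≡n x≤p) ⟩
      + p                     ≡⟨ *-identityˡ (+ p) ⟨
      + 1 * + p               ∎)
    where
    open ≡-Reasoning
    negate : ∀ a b → a - - + 1 * b ≡ a + b
    negate = solve-∀

  -- For 2m ≤ p the two residues ±m are m and p - m, and both have height m.
  height-≡± : ∀ {p y m} → y ℕ.< p → y ≡± m [mod p ] → 1 ℕ.≤ m → 2 ℕ.* m ℕ.≤ p → height p y ≡ m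
  height-≡± {p} {y} {m} y<p (_ , ±u , p∣y-um) 1≤m 2m≤p = bySign ±u p∣y-um
    where
    open ≡-Reasoning
    m+m≤p : m ℕ.+ m ℕ.≤ p
    m+m≤p = subst (ℕ._≤ p) (cong (m ℕ.+_) (ℕ.+-identityʳ m)) 2m≤p
    m≤p∸m = ℕ.m+n≤o⇒m≤o∸n m m+m≤p
    m≤p   = ℕ.m+n≤o⇒m≤o m m+m≤p
    m<p   = ℕ.<-≤-trans (ℕ.m<m+n m 1≤m) m+m≤p
    bySign : ∀ {u} → IsSign u → + p ∣ + y - u * + m → height p y ≡ m
    bySign (inj₁ refl) p∣y-m = begin
      height p y   ≡⟨ cong (height p) (residues-≡ y<p m<p (subst (+ p ∣_) (one (+ y) (+ m)) p∣y-m)) ⟩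
      m ⊓ (p ∸ m)  ≡⟨ ℕ.m≤n⇒m⊓n≡m m≤p∸m ⟩
      m            ∎
      where
      one : ∀ a b → a - + 1 * b ≡ a - b
      one = solve-∀
    bySign (inj₂ refl) p∣y+m = begin
      height p y              ≡⟨ cong (height p) (residues-≡ y<p p∸m<p p∣y-[p-m]) ⟩
      (p ∸ m) ⊓ (p ∸ (p ∸ m)) ≡⟨ cong ((p ∸ m) ⊓_) (ℕ.m∸[m∸n]≡n m≤p) ⟩
      (p ∸ m) ⊓ m             ≡⟨ ℕ.m≥n⇒m⊓n≡n m≤p∸m ⟩
      m                       ∎
      where
      p∸m<p = ℕ.∸-monoʳ-< 1≤m m≤p
      shift : ∀ a b c → a - - + 1 * b - c ≡ a - (c - b)
      shift = solve-∀
      p∣y-[p-m] : + p ∣ + y - + (p ∸ m)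
      p∣y-[p-m] = subst (+ p ∣_) (trans (shift (+ y) (+ m) (+ p)) (cong (λ z → + y - z) (trans (m-n≡m⊖n p m) (⊖-≥ m≤p))))
                    (∣m∣n⇒∣m-n p∣y+m ∣-refl)

  *-^-distrib : ∀ x y t → (x ℕ.* y) ℕ.^ t ≡ x ℕ.^ t ℕ.* y ℕ.^ t
  *-^-distrib x y zero    = refl
  *-^-distrib x y (suc t) = trans (cong (x ℕ.* y ℕ.*_) (*-^-distrib x y t)) (regroup x y (x ℕ.^ t) (y ℕ.^ t))
    where
    regroup : ∀ a b c d → a ℕ.* b ℕ.* (c ℕ.* d) ≡ a ℕ.* c ℕ.* (b ℕ.* d)
    regroup = ℕ-solve-∀

  module Subgroup (p t : ℕ) .{{_ : NonZero p}} (1<p : 1 ℕ.< p) where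

    1%p≡1 : 1 % p ≡ 1
    1%p≡1 = m<n⇒m%n≡m 1<p

    InG-1 : InG p t 1
    InG-1 = trans (cong (_% p) (ℕ.^-zeroˡ t)) 1%p≡1

    InG-* : ∀ {x y} → InG p t x → InG p t y → InG p t (x ℕ.* y)
    InG-* {x} {y} x∈G y∈G = begin
      ((x ℕ.* y) ℕ.^ t) % p                    ≡⟨ cong (_% p) (*-^-distrib x y t) ⟩
      (x ℕ.^ t ℕ.* y ℕ.^ t) % p                ≡⟨ %-distribˡ-* (x ℕ.^ t) (y ℕ.^ t) p ⟩
      ((x ℕ.^ t) % p ℕ.* ((y ℕ.^ t) % p)) % p  ≡⟨ cong₂ (λ a b → (a ℕ.* b) % p) x∈G y∈G ⟩
      1 % p                                     ≡⟨ 1%p≡1 ⟩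
      1                                         ∎
      where open ≡-Reasoning

    InG-^ : ∀ {x} e → InG p t x → InG p t (x ℕ.^ e)
    InG-^ zero    _   = InG-1
    InG-^ (suc e) x∈G = InG-* x∈G (InG-^ e x∈G)

    InG-% : ∀ {x} → InG p t x → InG p t (x % p)
    InG-% {x} x∈G = trans (%^%≡^% t) x∈G
      where
      %^%≡^% : ∀ t → ((x % p) ℕ.^ t) % p ≡ (x ℕ.^ t) % p
      %^%≡^% zero    = refl
      %^%≡^% (suc t) = begin
        ((x % p) ℕ.* (x % p) ℕ.^ t) % p            ≡⟨ %-distribˡ-* (x % p) ((x % p) ℕ.^ t) p ⟩
        ((x % p % p) ℕ.* (((x % p) ℕ.^ t) % p)) % p ≡⟨ cong₂ (λ a b → (a ℕ.* b) % p) (m%n%n≡m%n x p) (%^%≡^% t) ⟩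
        ((x % p) ℕ.* ((x ℕ.^ t) % p)) % p          ≡⟨ %-distribˡ-* x (x ℕ.^ t) p ⟨
        (x ℕ.* x ℕ.^ t) % p                         ∎
        where open ≡-Reasoning

  powMinusOne : ℕ → List ℤ
  powMinusOne t = - + 1 ∷ replicate t (+ 0)

  evalMonic-powMinusOne : ∀ t x → evalMonic (powMinusOne t) (+ x) ≡ + (x ℕ.^ suc t) - + 1
  evalMonic-powMinusOne t x = begin
    - + 1 + + x * evalMonic (replicate t (+ 0)) (+ x) ≡⟨ cong (λ z → - + 1 + + x * z) (evalMonic-monomial t) ⟩
    - + 1 + + x * + (x ℕ.^ t)                          ≡⟨ cong (λ z → - + 1 + z) (pos-* x (x ℕ.^ t)) ⟨
    - + 1 + + (x ℕ.^ suc t)                            ≡⟨ +-comm (- + 1) (+ (x ℕ.^ suc t)) ⟩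
    + (x ℕ.^ suc t) - + 1                              ∎
    where
    open ≡-Reasoning
    evalMonic-monomial : ∀ t → evalMonic (replicate t (+ 0)) (+ x) ≡ + (x ℕ.^ t)
    evalMonic-monomial zero    = refl
    evalMonic-monomial (suc t) =
      trans (+-identityˡ _) (trans (cong (+ x *_) (evalMonic-monomial t)) (sym (pos-* x (x ℕ.^ t))))

  InG⇒root : ∀ {p t x} .{{_ : NonZero p}} → InG p (suc t) x → + p ∣ evalMonic (powMinusOne t) (+ x)
  InG⇒root {p} {t} {x} x∈G = subst (+ p ∣_) (trans flip (sym (evalMonic-powMinusOne t x))) (∣m⇒∣-m p∣1-xᵗ⁺¹)
    where
    p∣1-xᵗ⁺¹ : + p ∣ + 1 - + (x ℕ.^ suc t)
    p∣1-xᵗ⁺¹ = subst (λ r → + p ∣ + r - + (x ℕ.^ suc t)) x∈G (%-congruent p (x ℕ.^ suc t))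
    flip : - (+ 1 - + (x ℕ.^ suc t)) ≡ + (x ℕ.^ suc t) - + 1
    flip = negate-minus (+ 1) (+ (x ℕ.^ suc t))
      where
      negate-minus : ∀ a b → - (a - b) ≡ b - a
      negate-minus = solve-∀

module Heights where

  open import Data.Nat
  open import Data.Nat.Properties
  open import Data.Nat.Combinatorics using (_C_)
  open import Data.Nat.DivMod using (_%_; m%n<n; m<n⇒m%n≡m)
  open import Data.Nat.Divisibility using (∣⇒≤)
  open import Data.Nat.Primality using (Prime; prime?)
  import Data.Integer as ℤ
  open import Data.Integer.Divisibility.Signed using (_∣_)
  open import Data.List using (List; []; _∷_; length; map; filter; upTo; deduplicate)
  open import Data.List.Properties using (length-map; length-replicate)
  open import Data.List.Relation.Unary.All as All using (All; []; _∷_)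
  import Data.List.Relation.Unary.All.Properties as All
  open import Data.List.Relation.Binary.Pointwise.Properties using (Pointwise-length)
  open import Data.List.Relation.Unary.Unique.Propositional using (Unique)
  open import Data.List.Membership.Propositional using (_∈_)
  open import Data.List.Membership.Propositional.Properties
    using (∈-map⁻; ∈-map⁺; ∈-filter⁺; ∈-filter⁻; ∈-upTo⁺; ∈-upTo⁻; ∈-deduplicate⁻)
  open import Data.Product using (Σ; _×_; _,_; proj₁; proj₂)
  open import Function.Base using (_∘_)
  open import Relation.Nullary using (¬_; contradiction)
  open import Relation.Nullary.Decidable using (decidable-stable)
  open import Relation.Binary.PropositionalEquality
  open import Defs
  open MonicRoots using (evalMonic; roots≤degree)
  open Valuation
  open Exponents
  open Counting
    using (Unique-⊆⇒length≤; Unique-map⁺; map-≡⇒≡; compositions; length-compositions; ∈-compositions⇒; compositions-unique)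
  open Elimination
    using (Descending; combination; Independent; Independent⇒injective; EchelonBasis; SupportedBelow)
  open SmallPrimes
  open PowerProducts
  open Congruences

  exponent-powerProduct : ∀ {A : Set} (g : A → ℕ) {xs} → All (λ x → 1 ≤ g x) xs → ∀ es q →
    exponent (powerProduct (map g xs) es) q ≡ combination (exponent ∘ g) (map ℤ.+_ es) xs q
  exponent-powerProduct g []             []       q = exponent-1 q
  exponent-powerProduct g []             (_ ∷ _)  q = exponent-1 q
  exponent-powerProduct g (_ ∷ _)        []       q = exponent-1 q
  exponent-powerProduct g (1≤gx ∷ 1≤gxs) (e ∷ es) q =
    trans (exponent-* (1≤^ e 1≤gx) (powerProduct≥1 (All.map⁺ 1≤gxs) es) q)
          (cong₂ ℤ._+_ (exponent-^ 1≤gx e q) (exponent-powerProduct g 1≤gxs es q))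

  ≡±-powerProduct : ∀ {p xs} → All (_≤ p) xs → ∀ es → powerProduct xs es ≡± powerProduct (map (height p) xs) es [mod p ]
  ≡±-powerProduct []          es       = ≡±-refl
  ≡±-powerProduct (_ ∷ _)     []       = ≡±-refl
  ≡±-powerProduct (x≤p ∷ xs≤p) (e ∷ es) = ≡±-* (≡±-^ e (≡±-height x≤p)) (≡±-powerProduct xs≤p es)

  InG-powerProduct : ∀ {p t xs} .{{_ : NonZero p}} → 1 < p → All (InG p t) xs → ∀ es → InG p t (powerProduct xs es)
  InG-powerProduct {p} {t} 1<p []            es       = InG-1 where open Subgroup p t 1<p
  InG-powerProduct {p} {t} 1<p (_ ∷ _)       []       = InG-1 where open Subgroup p t 1<p
  InG-powerProduct {p} {t} {x ∷ xs} 1<p (x∈G ∷ xs∈G) (e ∷ es) =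
    InG-* {x ^ e} (InG-^ {x} e x∈G) (InG-powerProduct {p} {t} 1<p xs∈G es)
    where open Subgroup p t 1<p

  independent⇒binomial≤ : ∀ {p t k r} .{{_ : NonZero p}} → Prime p → 1 ≤ k → 2 * k ^ r ≤ p →
    ∀ {B} → All (λ x → x < p × InG p (suc t) x × 1 ≤ height p x × height p x ≤ k) B →
    Independent (exponent ∘ height p) B → (r + length B) C length B ≤ suc t
  independent⇒binomial≤ {p} {t} {k} {r} prime[p] 1≤k 2kʳ≤p {B} B∈U independent = begin
    (r + d) C d                        ≡⟨ length-compositions d r ⟨
    length (compositions d r)          ≡⟨ length-map X (compositions d r) ⟨
    length (map X (compositions d r))
      ≤⟨ roots≤degree prime[p] (powMinusOne t) X-unique (All.tabulate X<p) (All.tabulate X-root) ⟩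
    length (powMinusOne t)             ≡⟨ cong suc (length-replicate t) ⟩
    suc t                              ∎
    where
    open ≤-Reasoning
    d = length B
    heights = map (height p) B
    X : List ℕ → ℕ
    X es = powerProduct B es % p
    B<p = All.map proj₁ B∈U
    B∈G = All.map (proj₁ ∘ proj₂) B∈U
    1≤heights = All.map (proj₁ ∘ proj₂ ∘ proj₂) B∈U
    heights≤k = All.map⁺ (All.map (proj₂ ∘ proj₂ ∘ proj₂) B∈U)

    X<p : ∀ {z} → z ∈ map X (compositions d r) → z < p
    X<p z∈ with ∈-map⁻ X z∈
    ... | es , _ , refl = m%n<n (powerProduct B es) p

    X-root : ∀ {z} → z ∈ map X (compositions d r) → ℤ.+ p ∣ evalMonic (powMinusOne t) (ℤ.+ z)
    X-root z∈ with ∈-map⁻ X z∈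
    ... | es , _ , refl =
      InG⇒root {p} {t} {X es} (InG-% {powerProduct B es} (InG-powerProduct {p} {suc t} (prime⇒≥2 prime[p]) B∈G es))
      where open Subgroup p (suc t) (prime⇒≥2 prime[p])

    height-X : ∀ {es} → es ∈ compositions d r → height p (X es) ≡ powerProduct heights es
    height-X {es} es∈ = height-≡± (m%n<n (powerProduct B es) p)
      (≡±-congˡ (%-congruent p (powerProduct B es)) (≡±-powerProduct (All.map <⇒≤ B<p) es))
      (powerProduct≥1 (All.map⁺ 1≤heights) es) 2m≤p
      where
      2m≤p : 2 * powerProduct heights es ≤ p
      2m≤p = ≤-trans (*-monoʳ-≤ 2 (≤-trans (powerProduct≤^sum 1≤k heights≤k es)
                                           (^-monoʳ-≤ k {{>-nonZero 1≤k}} (proj₂ (∈-compositions⇒ d r es∈))))) 2kʳ≤p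

    X-injective : ∀ {es es′} → es ∈ compositions d r → es′ ∈ compositions d r → X es ≡ X es′ → es ≡ es′
    X-injective {es} {es′} es∈ es′∈ Xes≡Xes′ =
      Independent⇒injective (exponent ∘ height p) independent
        (proj₁ (∈-compositions⇒ d r es∈)) (proj₁ (∈-compositions⇒ d r es′∈)) λ q →
          trans (sym (exponent-powerProduct (height p) 1≤heights es q))
                (trans (cong (λ h → exponent h q) heights≡) (exponent-powerProduct (height p) 1≤heights es′ q))
      where
      heights≡ = trans (sym (height-X es∈)) (trans (cong (height p) Xes≡Xes′) (height-X es′∈))

    X-unique : Unique (map X (compositions d r))
    X-unique = Unique-map⁺ X (compositions-unique d r) X-injective

  ∈-[1,k] : ∀ {n k} → 1 ≤ n → n ≤ k → n ∈ map suc (upTo k)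
  ∈-[1,k] {suc n} _ n<k = ∈-map⁺ suc (∈-upTo⁺ n<k)

  separated⇒length≤Psi : ∀ {b k s cs} → Descending b cs → All Prime cs → length cs ≤ s →
    ∀ {H} → Unique H → All (λ h → 1 ≤ h × h ≤ k) H →
    (∀ {h h′} → h ∈ H → h′ ∈ H → (∀ {c} → c ∈ cs → valuation c h ≡ valuation c h′) → h ≡ h′) →
    length H ≤ PsiIdx k s
  separated⇒length≤Psi {k = k} {s} {cs} desc[cs] prime[cs] |cs|≤s {H} uniqueH boundsH separated = begin
    length H                                      ≡⟨ length-map φ H ⟨
    length (map φ H)                              ≤⟨ Unique-⊆⇒length≤ (Unique-map⁺ φ uniqueH φ-injective) φ[H]⊆ ⟩
    length (filter (SmoothIdx? s) (map suc (upTo k))) ≡⟨⟩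
    PsiIdx k s                                    ∎
    where
    open ≤-Reasoning
    open InitialPrimes (initialPrimes cs desc[cs] prime[cs])
    φ : ℕ → ℕ
    φ h = powerProduct primes (valuationsAt cs h)
    |valuationsAt| : ∀ h → length (valuationsAt cs h) ≡ length primes
    |valuationsAt| h = trans (length-map _ cs) (sym (Pointwise-length pointwise≤))
    φ-injective : ∀ {h h′} → h ∈ H → h′ ∈ H → φ h ≡ φ h′ → h ≡ h′
    φ-injective h∈ h′∈ φh≡φh′ =
      separated h∈ h′∈ (map-≡⇒≡ (powerProduct-injective descending allPrime (|valuationsAt| _) (|valuationsAt| _) φh≡φh′))
    φ[H]⊆ : ∀ {z} → z ∈ map φ H → z ∈ filter (SmoothIdx? s) (map suc (upTo k))
    φ[H]⊆ z∈ with ∈-map⁻ φ z∈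
    ... | h , h∈ , refl =
      ∈-filter⁺ (SmoothIdx? s) (∈-[1,k] (powerProduct≥1 (primes≥1 allPrime) _) (≤-trans φh≤h h≤k)) smooth
      where
      1≤h = proj₁ (All.lookup boundsH h∈)
      h≤k = proj₂ (All.lookup boundsH h∈)
      φh≤h : φ h ≤ h
      φh≤h = ≤-trans (powerProduct-mono pointwise≤ (valuationsAt cs h))
                     (∣⇒≤ {{>-nonZero 1≤h}} (powerProduct-valuationsAt∣ desc[cs] prime[cs] 1≤h))
      smooth : SmoothIdx s (φ h)
      smooth = All.tabulate λ {q} _ prime[q] q∣φh →
        ≤-trans (primePi≤length (initialPrimes cs desc[cs] prime[cs]) (prime∣powerProduct⇒∈ allPrime prime[q] _ q∣φh))
                (≤-trans (≤-reflexive (Pointwise-length pointwise≤)) |cs|≤s)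

  nonzeroExponentColumn⇒prime : ∀ {A : Set} (g : A → ℕ) {L c} → ¬ (∀ a → a ∈ L → exponent (g a) c ≡ ℤ.+ 0) → Prime c
  nonzeroExponentColumn⇒prime g {c = c} column≢0 =
    decidable-stable (prime? c) λ ¬prime[c] → column≢0 λ a _ → exponent-nonPrime (g a) ¬prime[c]

  pivots-separate : ∀ {A : Set} {n} (g : A → ℕ) {L} (E : EchelonBasis n (exponent ∘ g) L) →
    ∀ {x x′} → x ∈ L → x′ ∈ L → 1 ≤ g x → 1 ≤ g x′ →
    (∀ {c} → c ∈ EchelonBasis.pivots E → valuation c (g x) ≡ valuation c (g x′)) → g x ≡ g x′
  pivots-separate g E {x} {x′} x∈L x′∈L 1≤gx 1≤gx′ ν≡ =
    exponent-injective 1≤gx 1≤gx′ (pivotsDetermine x∈L x′∈L λ c c∈ → begin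
      exponent (g x) c       ≡⟨ exponent-prime (g x) (prime[pivot] c∈) ⟩
      ℤ.+ valuation c (g x)  ≡⟨ cong ℤ.+_ (ν≡ c∈) ⟩
      ℤ.+ valuation c (g x′) ≡⟨ exponent-prime (g x′) (prime[pivot] c∈) ⟨
      exponent (g x′) c      ∎)
    where
    open ≡-Reasoning
    open EchelonBasis E
    prime[pivot] : ∀ {c} → c ∈ pivots → Prime c
    prime[pivot] c∈ = nonzeroExponentColumn⇒prime g (All.lookup pivotColumns≢0 c∈)

  ∈Ulist⇒ : ∀ {p k t x} .{{_ : NonZero p}} → 1 < p → 1 ≤ t → x ∈ Ulist p k t →
    x < p × InG p t x × 1 ≤ height p x × height p x ≤ k
  ∈Ulist⇒ {p} {k} {t@(suc _)} {x} 1<p _ x∈U with ∈-filter⁻ (InU? p k t) {xs = upTo p} x∈U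
  ... | x∈upTo , x∈G , height≤k = x<p , x∈G , ⊓-glb (x≢0 x x∈G) (m<n⇒0<n∸m x<p) , height≤k
    where
    x<p = ∈-upTo⁻ x∈upTo
    x≢0 : ∀ x → InG p t x → 1 ≤ x
    x≢0 zero    0∈G = contradiction (trans (sym (m<n⇒m%n≡m (<-trans z<s 1<p))) 0∈G) λ ()
    x≢0 (suc x) _   = s≤s z≤n

  module _ {p k t : ℕ} .{{_ : NonZero p}} (1<p : 1 < p) (1≤t : 1 ≤ t) where

    private
      U = Ulist p k t
      H = deduplicate _≟_ (map (height p) U)

      ∈U⇒ : ∀ {x} → x ∈ U → x < p × InG p t x × 1 ≤ height p x × height p x ≤ k
      ∈U⇒ = ∈Ulist⇒ 1<p 1≤t

      ∈H⇒ : ∀ {h} → h ∈ H → Σ ℕ λ x → x ∈ U × h ≡ height p x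
      ∈H⇒ h∈ = ∈-map⁻ (height p) (∈-deduplicate⁻ _≟_ (map (height p) U) h∈)

    exponents∘height-supported : SupportedBelow (suc k) (exponent ∘ height p) U
    exponents∘height-supported x x∈U q k<q =
      let _ , _ , 1≤h , h≤k = ∈U⇒ x∈U in exponent-< 1≤h q (<-≤-trans (s≤s h≤k) k<q)

    heights-bounded : All (λ h → 1 ≤ h × h ≤ k) H
    heights-bounded = All.tabulate λ h∈ → bounds (∈H⇒ h∈)
      where
      bounds : ∀ {h} → Σ ℕ (λ x → x ∈ U × h ≡ height p x) → 1 ≤ h × h ≤ k
      bounds (x , x∈U , refl) = proj₂ (proj₂ (∈U⇒ x∈U))

    heights-separated : ∀ {n} (E : EchelonBasis n (exponent ∘ height p) U) → ∀ {h h′} → h ∈ H → h′ ∈ H →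
      (∀ {c} → c ∈ EchelonBasis.pivots E → valuation c h ≡ valuation c h′) → h ≡ h′
    heights-separated E h∈ h′∈ with ∈H⇒ h∈ | ∈H⇒ h′∈
    ... | x , x∈U , refl | x′ , x′∈U , refl =
      pivots-separate (height p) E x∈U x′∈U (proj₁ (proj₂ (proj₂ (∈U⇒ x∈U)))) (proj₁ (proj₂ (proj₂ (∈U⇒ x′∈U))))

open import Defs
open import Data.Nat using (ℕ; suc; _*_; _∸_; _≤_; _<_; NonZero)
open import Data.Nat.Divisibility using (_∣_)
open import Data.Nat.Primality using (Prime)

open import Data.Nat using (_+_)
open import Data.Nat.Properties using (_≟_; <⇒≤)
open import Data.Nat.Combinatorics using (_C_)
open import Data.List using (length; map)
import Data.List.Relation.Unary.All as All
open import Data.List.Relation.Unary.Unique.DecPropositional.Properties using (deduplicate-!)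
open import Data.Product using (_,_)
open import Function.Base using (_∘_)
open import Relation.Binary.PropositionalEquality using (subst)
open Valuation using (prime⇒≥2)
open Exponents using (exponent)
open Elimination using (EchelonBasis; echelonBasis)
open Heights

corollary1p3 : (p t k : ℕ) .{{_ : NonZero p}} → Prime p → 2 < p →
    1 ≤ t → t ∣ p ∸ 1 → 1 < k → 2 * k < p →
    (r₀ s : ℕ) → IsR0 p k r₀ → IsS0 r₀ t s →
    numHeights p k t ≤ PsiIdx k s
corollary1p3 p t@(suc _) k prime[p] _ 1≤t _ 1<k _ r₀ s (2kʳ⁰≤p , _) (_ , maximal) =
  separated⇒length≤Psi descending (All.map (nonzeroExponentColumn⇒prime (height p)) pivotColumns≢0) d≤s
    (deduplicate-! _≟_ _) (heights-bounded 1<p 1≤t) (heights-separated 1<p 1≤t E)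
  where
  1<p = prime⇒≥2 prime[p]
  E = echelonBasis (suc k) (exponent ∘ height p) (Ulist p k t) (exponents∘height-supported 1<p 1≤t)
  open EchelonBasis E
  d≤s : length pivots ≤ s
  d≤s = maximal (length pivots) (subst (λ d → (r₀ + d) C d ≤ t) length-basis
          (independent⇒binomial≤ prime[p] (<⇒≤ 1<k) 2kʳ⁰≤p (All.map (∈Ulist⇒ 1<p 1≤t) basis⊆) independent))
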